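{- The following problem can be polytime-reduced to the restricted polynomial equivalence problem over $\mathrm{Mat}_2(\mathbb{Z}_2)$: given $k,n\in\mathbb{N}$ and expanded polynomials $p_1,\dots,p_k\in\mathbb{Z}_3[x_1,\dots,x_n]$, decide whether $\sum_{i=1}^k\alpha^{p_i(\mathbf{a})}=0$ for all $\mathbf{a}\in\{ -1,1\}^n$.
   Context: $\alpha$ is a primitive element of the field $\mathbb{F}_4$ (e.g. $\alpha=\begin{pmatrix}0&1\\1&1\end{pmatrix}$ in $\mathbb{F}_4=\{0,\alpha,\alpha^2,I\}\subseteq\mathrm{Mat}_2(\mathbb{Z}_2)$); since $\alpha^3=1$, $\alpha^t$ is defined for $t\in\mathbb{Z}_3$; $p_i(\mathbf{a})$ is computed in $\mathbb{Z}_3$ and the sum is taken in $\mathbb{F}_4$. An expanded polynomial is given as $\sum_{\mathbf{e}\in I}c_{\mathbf{e}}x_1^{e_1}\cdots x_n^{e_n}$ with $I\subseteq\{0,1,2\}^n$ and $c_{\mathbf{e}}\in\mathbb{Z}_3\setminus\{0\}$. A restricted polynomial expression over $\mathrm{Mat}_2(\mathbb{Z}_2)$ is a finite, possibly empty, formal sum of nonempty words over noncommuting variables and elements of $\mathrm{GL}_2(\mathbb{Z}_2)$, evaluated in the matrix ring; the restricted polynomial equivalence problem asks, given such $p$ in variables $x_1,\dots,x_n$, whether $p(\mathbf{x})=0$ for all $\mathbf{x}\in\mathrm{GL}_2(\mathbb{Z}_2)^n$. Polytime-reducible: there is a polynomial-time transformation $P$ of inputs with $A(e)\iff B(P(e))$.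 -}

module Defs where

open import Data.Bool using (Bool; true; false; _xor_; _∧_)
open import Data.Nat using (ℕ; zero; suc; _+_; _*_; _^_; _≤_)
open import Data.Nat.DivMod using (_mod_)
open import Data.Fin using (Fin; toℕ; _↑ˡ_)
  renaming (zero to fz; suc to fs)
open import Data.Vec using (Vec; []; _∷_; lookup; zipWith; foldr; replicate)
open import Data.List using (List; []; _∷_; _++_; map; concat; concatMap; takeWhile; length)
open import Data.List.NonEmpty using (List⁺; _∷_)
open import Data.List.Relation.Unary.All using (All)
open import Data.List.Relation.Unary.AllPairs using (AllPairs)
open import Data.Maybe using (Maybe; just; nothing; is-just)
open import Data.Product using (Σ; _×_; _,_; proj₁; proj₂; ∃; ∃-syntax)
open import Relation.Binary.PropositionalEquality using (_≡_; _≢_)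
open import Function.Bundles using (_⇔_)

ℤ₃ : Set
ℤ₃ = Fin 3

_+₃_ : ℤ₃ → ℤ₃ → ℤ₃
a +₃ b = (toℕ a + toℕ b) mod 3

_*₃_ : ℤ₃ → ℤ₃ → ℤ₃
a *₃ b = (toℕ a * toℕ b) mod 3

one₃ : ℤ₃
one₃ = fs fz

pow₃ : ℤ₃ → ℕ → ℤ₃
pow₃ a zero    = one₃
pow₃ a (suc e) = a *₃ pow₃ a e

-- 2×2 matrices over ℤ₂ (ℤ₂ = Bool with xor as + and ∧ as ·)

record Mat₂ : Set where
  constructor mat
  field
    m₁₁ m₁₂ m₂₁ m₂₂ : Bool
open Mat₂ public

_⊕_ : Mat₂ → Mat₂ → Mat₂
mat a b c d ⊕ mat a' b' c' d' = mat (a xor a') (b xor b') (c xor c') (d xor d')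

_⊗_ : Mat₂ → Mat₂ → Mat₂
mat a b c d ⊗ mat a' b' c' d' =
  mat ((a ∧ a') xor (b ∧ c')) ((a ∧ b') xor (b ∧ d'))
      ((c ∧ a') xor (d ∧ c')) ((c ∧ b') xor (d ∧ d'))

𝟎 : Mat₂
𝟎 = mat false false false false

𝐈 : Mat₂
𝐈 = mat true false false true

det : Mat₂ → Bool
det (mat a b c d) = (a ∧ d) xor (b ∧ c)

GL₂ : Set
GL₂ = Σ Mat₂ (λ m → det m ≡ true)

-- the primitive element α of 𝔽₄ = {0, α, α², I} ⊆ Mat₂(ℤ₂)
α : Mat₂
α = mat false true true true

αpow : ℕ → Mat₂
αpow zero    = 𝐈
αpow (suc t) = α ⊗ αpow t

-- α^t for t ∈ ℤ₃ (well defined since α³ = I)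
α^ : ℤ₃ → Mat₂
α^ t = αpow (toℕ t)

-- a term c · x₁^{e₁} ⋯ xₙ^{eₙ}
Term : ℕ → Set
Term n = ℤ₃ × Vec ℤ₃ n

Poly : ℕ → Set
Poly n = List (Term n)

IsExpanded : ∀ {n} → Poly n → Set
IsExpanded p = All (λ t → proj₁ t ≢ fz) p × AllPairs (λ s t → proj₂ s ≢ proj₂ t) p

evalTerm : ∀ {n} → Vec ℤ₃ n → Term n → ℤ₃
evalTerm a (c , e) = foldr (λ _ → ℤ₃) _*₃_ c (zipWith (λ x k → pow₃ x (toℕ k)) a e)

evalPoly : ∀ {n} → Vec ℤ₃ n → Poly n → ℤ₃
evalPoly a []      = fz
evalPoly a (t ∷ p) = evalTerm a t +₃ evalPoly a p

-- ±1 as elements of ℤ₃ (true ↦ 1, false ↦ -1 = 2)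
sign : Bool → ℤ₃
sign true  = fs fz
sign false = fs (fs fz)

record InstA : Set where
  field
    k n   : ℕ
    polys : Vec (Poly n) k
    expanded : All (λ p → IsExpanded p) (Data.Vec.toList polys)
open InstA public

sumα : ∀ {n k} → Vec ℤ₃ n → Vec (Poly n) k → Mat₂
sumα a ps = foldr (λ _ → Mat₂) (λ p acc → α^ (evalPoly a p) ⊕ acc) 𝟎 ps

ProbA : InstA → Set
ProbA e = (s : Vec Bool (n e)) → sumα (Data.Vec.map sign s) (polys e) ≡ 𝟎

data Letter (n : ℕ) : Set where
  var : Fin n → Letter n
  cst : GL₂ → Letter n

-- a finite (possibly empty) formal sum of nonempty words
RPoly : ℕ → Set
RPoly n = List (List⁺ (Letter n))

record InstB : Set where
  constructor instB
  field
    nvars : ℕ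
    expr  : RPoly nvars
open InstB public

evalLetter : ∀ {n} → Vec GL₂ n → Letter n → Mat₂
evalLetter x (var i) = proj₁ (lookup x i)
evalLetter x (cst g) = proj₁ g

evalWord : ∀ {n} → Vec GL₂ n → List⁺ (Letter n) → Mat₂
evalWord x (l ∷ ls) = go (evalLetter x l) ls
  where
  go : Mat₂ → List (Letter _) → Mat₂
  go acc []       = acc
  go acc (m ∷ ms) = go (acc ⊗ evalLetter x m) ms

evalRPoly : ∀ {n} → Vec GL₂ n → RPoly n → Mat₂
evalRPoly x []       = 𝟎
evalRPoly x (w ∷ ws) = evalWord x w ⊕ evalRPoly x ws

ProbB : InstB → Set
ProbB e = (x : Vec GL₂ (nvars e)) → evalRPoly x (expr e) ≡ 𝟎

Sym : Set
Sym = Fin 5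

d0 d1 d2 ♯ ▹ : Sym
d0 = fz
d1 = fs fz
d2 = fs (fs fz)
♯  = fs (fs (fs fz))
▹  = fs (fs (fs (fs fz)))

digit : ℤ₃ → Sym
digit x = x ↑ˡ 2

bit : Bool → Sym
bit false = d0
bit true  = d1

unary : ℕ → List Sym
unary zero    = []
unary (suc m) = d1 ∷ unary m

encTerm : ∀ {n} → Term n → List Sym
encTerm (c , e) = digit c ∷ Data.Vec.toList (Data.Vec.map digit e)

encPoly : ∀ {n} → Poly n → List Sym
encPoly p = concatMap encTerm p ++ (▹ ∷ [])

encA : InstA → List Sym
encA e = unary (k e) ++ ♯ ∷ unary (n e) ++ ♯ ∷
         concatMap encPoly (Data.Vec.toList (polys e))

encLetter : ∀ {n} → Letter n → List Sym
encLetter (var i)              = d2 ∷ unary (toℕ i) ++ (d0 ∷ [])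
encLetter (cst (mat a b c d , _)) = d0 ∷ bit a ∷ bit b ∷ bit c ∷ bit d ∷ []

encWord : ∀ {n} → List⁺ (Letter n) → List Sym
encWord (l ∷ ls) = concatMap encLetter (l ∷ ls) ++ (▹ ∷ [])

encB : InstB → List Sym
encB e = unary (nvars e) ++ ♯ ∷ concatMap encWord (expr e)

data Move : Set where
  L R S : Move

-- tape symbols: nothing = blank, just (s ↑ˡ g) = input symbol s,
-- other values = auxiliary work symbols
TSym : ℕ → Set
TSym g = Maybe (Fin (5 + g))

record TM : Set where
  field
    states : ℕ          -- states are Fin (suc states); fz is the start state
    aux    : ℕ
    δ      : Fin (suc states) → TSym aux →
             Maybe (Fin (suc states) × TSym aux × Move)   -- nothing = halt
open TM public

record Config (M : TM) : Set where
  constructor cfg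
  field
    state : Fin (suc (states M))
    left  : List (TSym (aux M))   -- cells left of the head, nearest first
    head  : TSym (aux M)
    right : List (TSym (aux M))   -- cells right of the head, nearest first
open Config public

embed : ∀ {g} → Sym → TSym g
embed {g} s = just (s ↑ˡ g)

initial : (M : TM) → List Sym → Config M
initial M []      = cfg fz [] nothing []
initial M (s ∷ w) = cfg fz [] (embed s) (map embed w)

moveL : ∀ {M} → Fin (suc (states M)) → List (TSym (aux M)) → TSym (aux M) →
        List (TSym (aux M)) → Config M
moveL q []      h r = cfg q [] nothing (h ∷ r)
moveL q (x ∷ l) h r = cfg q l x (h ∷ r)

moveR : ∀ {M} → Fin (suc (states M)) → List (TSym (aux M)) → TSym (aux M) →
        List (TSym (aux M)) → Config M
moveR q l h []      = cfg q (h ∷ l) nothing []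
moveR q l h (x ∷ r) = cfg q (h ∷ l) x r

step : (M : TM) → Config M → Config M
step M c with δ M (state c) (head c)
... | nothing            = c
... | just (q , s , L)   = moveL q (left c) s (right c)
... | just (q , s , R)   = moveR q (left c) s (right c)
... | just (q , s , S)   = cfg q (left c) s (right c)

steps : (M : TM) → ℕ → Config M → Config M
steps M zero    c = c
steps M (suc t) c = steps M t (step M c)

Halted : (M : TM) → Config M → Set
Halted M c = δ M (state c) (head c) ≡ nothing

output : ∀ {M} → Config M → List (TSym (aux M))
output c = takeWhile (λ x → Data.Bool.T? (is-just x)) (head c ∷ right c)

RunsTo : (M : TM) → List Sym → ℕ → List Sym → Set
RunsTo M w t v = Σ ℕ λ t' → t' ≤ t × Halted M (steps M t' (initial M w))
                 × output (steps M t' (initial M w)) ≡ map embed v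

PolyTimeComputable : {X Y : Set} → (X → List Sym) → (Y → List Sym) → (X → Y) → Set
PolyTimeComputable {X} encX encY f =
  Σ TM λ M → Σ ℕ λ c → (x : X) →
    RunsTo M (encX x) (c * (suc (length (encX x))) ^ c) (encY (f x))

PolyTimeReducible : {X Y : Set} → (X → List Sym) → (Y → List Sym) →
                    (X → Set) → (Y → Set) → Set
PolyTimeReducible {X} {Y} encX encY A B =
  Σ (X → Y) λ P → PolyTimeComputable encX encY P × ((e : X) → A e ⇔ B (P e))

-- A term c·x₁^e₁⋯xₙ^eₙ becomes the word X₁⋯Xₙ α^c Xₙ⋯X₁ with Xᵢ = xᵢxᵢxᵢ if eᵢ = 1 and
-- Xᵢ empty otherwise, a polynomial the product of its term words and the instance the sum of
-- these products.  GL₂(𝔽₂) ≅ S₃, so g³ is the identity for even g and the involution g for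
-- odd g, and conjugating α^t by it gives α^(±t).  Writing s(g) = ±1 for the parity, a word
-- thus evaluates to α^(p(s(x₁),…,s(xₙ))) (exponents 2 contribute s(xᵢ)² = 1), and as s is onto
-- {±1} the two problems have the same yes-instances.
--
-- The transformation is computed by a queue automaton (read the front symbol, append a word
-- at the back).  Each sweep over the queue consumes one digit of every polynomial, so the
-- words grow from the inside out, and a last sweep translates into the output alphabet.  A
-- Turing machine simulates one automaton step by a round trip over its tape; as the queue
-- stays of length O(L²) during O(L²) sweeps for input length L, the machine halts within
-- O(L⁶) ≤ 18·(L+1)^18 steps.

module Submission where

open import Defs
open import Data.Bool using (Bool; true; false; _∧_; _∨_; not; T)
open import Data.Nat using (ℕ; zero; suc; _+_; _*_; _^_; _∸_; _≤_; _<_; z≤n; s≤s; _≤ᵇ_; _≤?_)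
open import Data.Nat.Properties
open import Data.Nat.Tactic.RingSolver using (solve-∀)
open import Data.Fin using (Fin; toℕ; opposite; #_; join; splitAt; combine; remQuot; _↑ˡ_)
  renaming (zero to fz; suc to fs)
import Data.Fin.Properties as FinP
open import Data.Vec using (Vec; []; _∷_; lookup; tabulate; allFin)
import Data.Vec as V
import Data.Vec.Properties as VP
open import Data.List using (List; []; _∷_; _++_; map; fromMaybe; length; concatMap; replicate; take; drop; reverse; takeWhile)
import Data.List.Properties as LP
open import Data.List.NonEmpty using (List⁺; _∷_)
open import Data.List.Relation.Unary.All using (All; []; _∷_)
import Data.List.Relation.Unary.All.Properties as AllP
open import Data.List.Relation.Unary.Any using (Any; here; there)
open import Data.Maybe using (Maybe; just; nothing)
open import Data.Product using (Σ; _×_; _,_; proj₁; proj₂)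
open import Data.Sum using (_⊎_; inj₁; inj₂; [_,_]′)
open import Data.Unit using (⊤; tt)
open import Data.Empty using (⊥; ⊥-elim)
open import Relation.Nullary using (yes; no)
open import Relation.Binary.PropositionalEquality
open import Function using (_∘_)
open import Function.Bundles using (_⇔_; mk⇔)

-- Identities in Mat₂(ℤ₂) by enumeration

all-Bool : (Bool → Bool) → Bool
all-Bool p = p true ∧ p false

∧-elimˡ : ∀ {a b} → a ∧ b ≡ true → a ≡ true
∧-elimˡ {true} _ = refl

∧-elimʳ : ∀ {a b} → a ∧ b ≡ true → b ≡ true
∧-elimʳ {true} e = e

all-Bool-sound : ∀ p → all-Bool p ≡ true → ∀ b → p b ≡ true
all-Bool-sound p e true = ∧-elimˡ e
all-Bool-sound p e false = ∧-elimʳ {p true} e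

all-Mat₂ : (Mat₂ → Bool) → Bool
all-Mat₂ p = all-Bool (λ a → all-Bool (λ b → all-Bool (λ c → all-Bool (λ d → p (mat a b c d)))))

all-Mat₂-sound : ∀ p → all-Mat₂ p ≡ true → ∀ m → p m ≡ true
all-Mat₂-sound p e (mat a b c d) =
  all-Bool-sound (λ d → p (mat a b c d))
    (all-Bool-sound (λ c → all-Bool (λ d → p (mat a b c d)))
      (all-Bool-sound (λ b → all-Bool (λ c → all-Bool (λ d → p (mat a b c d))))
        (all-Bool-sound (λ a → all-Bool (λ b → all-Bool (λ c → all-Bool (λ d → p (mat a b c d))))) e a) b) c) d

eqBool : Bool → Bool → Bool
eqBool true b = b
eqBool false b = not b

eqBool-sound : ∀ a b → eqBool a b ≡ true → a ≡ b
eqBool-sound true true _ = refl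
eqBool-sound false false _ = refl

eqMat₂ : Mat₂ → Mat₂ → Bool
eqMat₂ (mat a b c d) (mat a' b' c' d') = eqBool a a' ∧ eqBool b b' ∧ eqBool c c' ∧ eqBool d d'

eqMat₂-sound : ∀ m m' → eqMat₂ m m' ≡ true → m ≡ m'
eqMat₂-sound (mat a b c d) (mat a' b' c' d') e
  rewrite eqBool-sound a a' (∧-elimˡ e)
        | eqBool-sound b b' (∧-elimˡ (∧-elimʳ {eqBool a a'} e))
        | eqBool-sound c c' (∧-elimˡ (∧-elimʳ {eqBool b b'} (∧-elimʳ {eqBool a a'} e)))
        | eqBool-sound d d' (∧-elimʳ {eqBool c c'} (∧-elimʳ {eqBool b b'} (∧-elimʳ {eqBool a a'} e))) = refl

all-Mat₂²-sound : ∀ (p : Mat₂ → Mat₂ → Bool) → all-Mat₂ (λ a → all-Mat₂ (p a)) ≡ true → ∀ a b → p a b ≡ true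
all-Mat₂²-sound p e a = all-Mat₂-sound (p a) (all-Mat₂-sound (λ a → all-Mat₂ (p a)) e a)

all-Mat₂³-sound : ∀ (p : Mat₂ → Mat₂ → Mat₂ → Bool) →
                  all-Mat₂ (λ a → all-Mat₂ (λ b → all-Mat₂ (p a b))) ≡ true → ∀ a b c → p a b c ≡ true
all-Mat₂³-sound p e a b = all-Mat₂-sound (p a b) (all-Mat₂²-sound (λ a b → all-Mat₂ (p a b)) e a b)

⊗-assoc : ∀ a b c → (a ⊗ b) ⊗ c ≡ a ⊗ (b ⊗ c)
⊗-assoc a b c = eqMat₂-sound ((a ⊗ b) ⊗ c) (a ⊗ (b ⊗ c)) (all-Mat₂³-sound (λ a b c → eqMat₂ ((a ⊗ b) ⊗ c) (a ⊗ (b ⊗ c))) refl a b c)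

⊗-identityʳ : ∀ a → a ⊗ 𝐈 ≡ a
⊗-identityʳ a = eqMat₂-sound (a ⊗ 𝐈) a (all-Mat₂-sound (λ a → eqMat₂ (a ⊗ 𝐈) a) refl a)

⊗-identityˡ : ∀ a → 𝐈 ⊗ a ≡ a
⊗-identityˡ a = eqMat₂-sound (𝐈 ⊗ a) a (all-Mat₂-sound (λ a → eqMat₂ (𝐈 ⊗ a) a) refl a)

implies : Bool → Bool → Bool
implies true b = b
implies false b = true

implies-sound : ∀ a b → implies a b ≡ true → a ≡ true → b ≡ true
implies-sound true b e _ = e

det-⊗ : ∀ a b → det a ≡ true → det b ≡ true → det (a ⊗ b) ≡ true
det-⊗ a b da = implies-sound (det b) (det (a ⊗ b)) (implies-sound (det a) (implies (det b) (det (a ⊗ b)))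
  (all-Mat₂²-sound (λ a b → implies (det a) (implies (det b) (det (a ⊗ b)))) refl a b) da)

-- The reduction and its correctness

αᴳ : ℤ₃ → GL₂
αᴳ fz = α^ fz , refl
αᴳ (fs fz) = α^ (fs fz) , refl
αᴳ (fs (fs fz)) = α^ (fs (fs fz)) , refl

αᴳ-matrix : ∀ c → proj₁ (αᴳ c) ≡ α^ c
αᴳ-matrix fz = refl
αᴳ-matrix (fs fz) = refl
αᴳ-matrix (fs (fs fz)) = refl

𝐈ᴳ : GL₂
𝐈ᴳ = 𝐈 , refl

cubeLetters : ∀ {n} → ℤ₃ → Fin n → List (Letter n)
cubeLetters (fs fz) i = var i ∷ var i ∷ var i ∷ []
cubeLetters fz i = []
cubeLetters (fs (fs fz)) i = []

termLetters : ∀ {n m} → (Fin m → Fin n) → ℤ₃ → Vec ℤ₃ m → List (Letter n)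
termLetters ι c [] = cst (αᴳ c) ∷ []
termLetters ι c (e ∷ es) = cubeLetters e (ι fz) ++ termLetters (ι ∘ fs) c es ++ cubeLetters e (ι fz)

-- Polynomial variable i is matrix variable n ∸ 1 ∸ i: the machine numbers a variable by the
-- number of exponents following it in the term.
termWord : ∀ {n} → Term n → List (Letter n)
termWord (c , es) = termLetters opposite c es

-- Words are nonempty, so an empty product is written as the constant 𝐈.
nonEmpty : ∀ {n} → List (Letter n) → List⁺ (Letter n)
nonEmpty [] = cst 𝐈ᴳ ∷ []
nonEmpty (x ∷ xs) = x ∷ xs

polyWord : ∀ {n} → Poly n → List⁺ (Letter n)
polyWord p = nonEmpty (concatMap termWord p)

reduce : InstA → InstB
reduce e = instB (n e) (V.toList (V.map polyWord (polys e)))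

module _ {n : ℕ} (x : Vec GL₂ n) where
  evalLetters : List (Letter n) → Mat₂
  evalLetters [] = 𝐈
  evalLetters (l ∷ ls) = evalLetter x l ⊗ evalLetters ls

  det-evalLetter : ∀ l → det (evalLetter x l) ≡ true
  det-evalLetter (var i) = proj₂ (lookup x i)
  det-evalLetter (cst g) = proj₂ g

  evalWord-∷ : ∀ l ms → evalWord x (l ∷ ms) ≡ evalLetter x l ⊗ evalLetters ms
  evalWord-∷ l [] = sym (⊗-identityʳ (evalLetter x l))
  evalWord-∷ l (m ∷ ms) = trans (evalWord-∷ (cst (evalLetter x l ⊗ evalLetter x m , det-⊗ (evalLetter x l) (evalLetter x m) (det-evalLetter l) (det-evalLetter m))) ms) (⊗-assoc (evalLetter x l) (evalLetter x m) (evalLetters ms))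

  evalWord-nonEmpty : ∀ ws → evalWord x (nonEmpty ws) ≡ evalLetters ws
  evalWord-nonEmpty [] = ⊗-identityʳ 𝐈
  evalWord-nonEmpty (w ∷ ws) = evalWord-∷ w ws

  evalLetters-++ : ∀ xs ys → evalLetters (xs ++ ys) ≡ evalLetters xs ⊗ evalLetters ys
  evalLetters-++ [] ys = sym (⊗-identityˡ (evalLetters ys))
  evalLetters-++ (l ∷ xs) ys = trans (cong (evalLetter x l ⊗_) (evalLetters-++ xs ys)) (sym (⊗-assoc (evalLetter x l) (evalLetters xs) (evalLetters ys)))

cube : Mat₂ → Mat₂
cube g = g ⊗ (g ⊗ (g ⊗ 𝐈))

cubeIsIdentity : Mat₂ → Bool
cubeIsIdentity g = eqMat₂ (cube g) 𝐈

matrixSign : Mat₂ → ℤ₃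
matrixSign g = sign (cubeIsIdentity g)

conj-check : ℤ₃ → Mat₂ → Bool
conj-check t g = implies (det g) (eqMat₂ (cube g ⊗ (α^ t ⊗ cube g)) (α^ (matrixSign g *₃ t)))

all-conj-check : ∀ t → all-Mat₂ (conj-check t) ≡ true
all-conj-check fz = refl
all-conj-check (fs fz) = refl
all-conj-check (fs (fs fz)) = refl

cube-conj-α^ : ∀ g → det g ≡ true → ∀ t → cube g ⊗ (α^ t ⊗ cube g) ≡ α^ (matrixSign g *₃ t)
cube-conj-α^ g d t =
  eqMat₂-sound (cube g ⊗ (α^ t ⊗ cube g)) (α^ (matrixSign g *₃ t))
    (implies-sound (det g) (eqMat₂ (cube g ⊗ (α^ t ⊗ cube g)) (α^ (matrixSign g *₃ t))) (all-Mat₂-sound (conj-check t) (all-conj-check t) g) d)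

sign²≡1 : ∀ b → pow₃ (sign b) 2 ≡ one₃
sign²≡1 true = refl
sign²≡1 false = refl

*₃-identityˡ : ∀ t → one₃ *₃ t ≡ t
*₃-identityˡ fz = refl
*₃-identityˡ (fs fz) = refl
*₃-identityˡ (fs (fs fz)) = refl

*₃-identityʳ : ∀ t → t *₃ one₃ ≡ t
*₃-identityʳ fz = refl
*₃-identityʳ (fs fz) = refl
*₃-identityʳ (fs (fs fz)) = refl

α^-+₃ : ∀ u v → α^ u ⊗ α^ v ≡ α^ (u +₃ v)
α^-+₃ fz fz = refl
α^-+₃ fz (fs fz) = refl
α^-+₃ fz (fs (fs fz)) = refl
α^-+₃ (fs fz) fz = refl
α^-+₃ (fs fz) (fs fz) = refl
α^-+₃ (fs fz) (fs (fs fz)) = refl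
α^-+₃ (fs (fs fz)) fz = refl
α^-+₃ (fs (fs fz)) (fs fz) = refl
α^-+₃ (fs (fs fz)) (fs (fs fz)) = refl

evalMonomial : ∀ {m} → (Fin m → ℤ₃) → ℤ₃ → Vec ℤ₃ m → ℤ₃
evalMonomial f c [] = c
evalMonomial f c (e ∷ es) = pow₃ (f fz) (toℕ e) *₃ evalMonomial (f ∘ fs) c es

evalMonomial-cong : ∀ {m} (f g : Fin m → ℤ₃) → (∀ i → f i ≡ g i) → ∀ c es → evalMonomial f c es ≡ evalMonomial g c es
evalMonomial-cong f g h c [] = refl
evalMonomial-cong f g h c (e ∷ es) = cong₂ (λ u v → pow₃ u (toℕ e) *₃ v) (h fz) (evalMonomial-cong (f ∘ fs) (g ∘ fs) (h ∘ fs) c es)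

evalTerm≡evalMonomial : ∀ {m} (a : Vec ℤ₃ m) c es → evalTerm a (c , es) ≡ evalMonomial (lookup a) c es
evalTerm≡evalMonomial [] c [] = refl
evalTerm≡evalMonomial (a ∷ as) c (e ∷ es) = cong (pow₃ a (toℕ e) *₃_) (evalTerm≡evalMonomial as c es)

module _ {n : ℕ} (x : Vec GL₂ n) where
  varSign : Fin n → ℤ₃
  varSign i = matrixSign (proj₁ (lookup x i))

  varSign-isSign : ∀ i → Σ Bool (λ b → varSign i ≡ sign b)
  varSign-isSign i = cubeIsIdentity (proj₁ (lookup x i)) , refl

  evalLetters-termLetters : ∀ {m} (ι : Fin m → Fin n) c es → evalLetters x (termLetters ι c es) ≡ α^ (evalMonomial (varSign ∘ ι) c es)
  evalLetters-termLetters ι c [] = trans (⊗-identityʳ (proj₁ (αᴳ c))) (αᴳ-matrix c)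
  evalLetters-termLetters ι c (fz ∷ es) = trans (cong (evalLetters x) (LP.++-identityʳ (termLetters (ι ∘ fs) c es)))
    (trans (evalLetters-termLetters (ι ∘ fs) c es) (cong α^ (sym (*₃-identityˡ _))))
  evalLetters-termLetters ι c (fs fz ∷ es) = begin
      evalLetters x (C ++ W ++ C) ≡⟨ evalLetters-++ x C (W ++ C) ⟩
      evalLetters x C ⊗ evalLetters x (W ++ C) ≡⟨ cong (evalLetters x C ⊗_) (evalLetters-++ x W C) ⟩
      cube g ⊗ (evalLetters x W ⊗ cube g) ≡⟨ cong (λ z → cube g ⊗ (z ⊗ cube g)) (evalLetters-termLetters (ι ∘ fs) c es) ⟩
      cube g ⊗ (α^ t ⊗ cube g) ≡⟨ cube-conj-α^ g (proj₂ (lookup x (ι fz))) t ⟩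
      α^ (matrixSign g *₃ t) ≡⟨ cong (λ u → α^ (u *₃ t)) (sym (*₃-identityʳ (matrixSign g))) ⟩
      α^ ((matrixSign g *₃ one₃) *₃ t) ∎
    where
    open ≡-Reasoning
    g = proj₁ (lookup x (ι fz))
    C = cubeLetters {n} (fs fz) (ι fz)
    W = termLetters (ι ∘ fs) c es
    t = evalMonomial (varSign ∘ ι ∘ fs) c es
  evalLetters-termLetters ι c (fs (fs fz) ∷ es) = trans (cong (evalLetters x) (LP.++-identityʳ (termLetters (ι ∘ fs) c es)))
    (trans (evalLetters-termLetters (ι ∘ fs) c es) (cong α^ (sym (trans (cong (_*₃ t) (sq (varSign-isSign (ι fz)))) (*₃-identityˡ t)))))
    where
    t = evalMonomial (varSign ∘ ι ∘ fs) c es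
    sq : Σ Bool (λ b → varSign (ι fz) ≡ sign b) → pow₃ (varSign (ι fz)) 2 ≡ one₃
    sq (b , eq) = trans (cong (λ u → pow₃ u 2) eq) (sign²≡1 b)

  evalLetters-polyLetters : (a : Vec ℤ₃ n) → (∀ i → varSign (opposite i) ≡ lookup a i) →
             ∀ p → evalLetters x (concatMap termWord p) ≡ α^ (evalPoly a p)
  evalLetters-polyLetters a h [] = refl
  evalLetters-polyLetters a h ((c , es) ∷ p) = begin
      evalLetters x (termWord (c , es) ++ concatMap termWord p) ≡⟨ evalLetters-++ x (termWord (c , es)) _ ⟩
      evalLetters x (termWord (c , es)) ⊗ evalLetters x (concatMap termWord p) ≡⟨ cong₂ _⊗_ (evalLetters-termLetters opposite c es) (evalLetters-polyLetters a h p) ⟩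
      α^ (evalMonomial (varSign ∘ opposite) c es) ⊗ α^ (evalPoly a p) ≡⟨ α^-+₃ (evalMonomial (varSign ∘ opposite) c es) (evalPoly a p) ⟩
      α^ (evalMonomial (varSign ∘ opposite) c es +₃ evalPoly a p)
        ≡⟨ cong (λ u → α^ (u +₃ evalPoly a p)) (trans (evalMonomial-cong _ _ h c es) (sym (evalTerm≡evalMonomial a c es))) ⟩
      α^ (evalPoly a ((c , es) ∷ p)) ∎
    where open ≡-Reasoning

  evalRPoly-reduce : ∀ {k} (a : Vec ℤ₃ n) → (∀ i → varSign (opposite i) ≡ lookup a i) →
           (ps : Vec (Poly n) k) → evalRPoly x (V.toList (V.map polyWord ps)) ≡ sumα a ps
  evalRPoly-reduce a h [] = refl
  evalRPoly-reduce a h (p ∷ ps) = cong₂ _⊕_ (trans (evalWord-nonEmpty x (concatMap termWord p)) (evalLetters-polyLetters a h p)) (evalRPoly-reduce a h ps)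

τᴳ : GL₂
τᴳ = mat false true true false , refl

signMatrix : Bool → GL₂
signMatrix true = 𝐈ᴳ
signMatrix false = τᴳ

matrixSign-signMatrix : ∀ b → matrixSign (proj₁ (signMatrix b)) ≡ sign b
matrixSign-signMatrix true = refl
matrixSign-signMatrix false = refl

reduction-correct : (e : InstA) → ProbA e ⇔ ProbB (reduce e)
reduction-correct e = mk⇔ to from
  where
  to : ProbA e → ProbB (reduce e)
  to pa x = trans (evalRPoly-reduce x (V.map sign s) h (polys e)) (pa s)
    where
    s = tabulate (λ i → cubeIsIdentity (proj₁ (lookup x (opposite i))))
    h : ∀ i → varSign x (opposite i) ≡ lookup (V.map sign s) i
    h i = sym (trans (VP.lookup-map i sign s) (cong sign (VP.lookup∘tabulate _ i)))
  from : ProbB (reduce e) → ProbA e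
  from pb s = trans (sym (evalRPoly-reduce x (V.map sign s) h (polys e))) (pb x)
    where
    x = tabulate (λ v → signMatrix (lookup s (opposite v)))
    h : ∀ i → varSign x (opposite i) ≡ lookup (V.map sign s) i
    h i = begin
        matrixSign (proj₁ (lookup x (opposite i))) ≡⟨ cong (λ g → matrixSign (proj₁ g)) (VP.lookup∘tabulate _ (opposite i)) ⟩
        matrixSign (proj₁ (signMatrix (lookup s (opposite (opposite i))))) ≡⟨ cong (λ j → matrixSign (proj₁ (signMatrix (lookup s j)))) (FinP.opposite-involutive i) ⟩
        matrixSign (proj₁ (signMatrix (lookup s i))) ≡⟨ matrixSign-signMatrix (lookup s i) ⟩
        sign (lookup s i) ≡⟨ sym (VP.lookup-map i sign s) ⟩
        lookup (V.map sign s) i ∎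
      where open ≡-Reasoning

-- A queue automaton computing the reduction

-- Queue alphabet: the input symbols d0 d1 d2 ♯ ▹ (D0 D1 D2 SH TR), header cells Ch CH CZ,
-- the sweep end marker CR, the active-term marker CS, the symbols A2 A1 A0 spelling a variable
-- x_m as A2 A1^m A0 (output as d2 1^m d0), and M0 M1 M2 for the constants α^c.
Γ : Set
Γ = Fin 16

pattern D0 = fz
pattern D1 = fs fz
pattern D2 = fs (fs fz)
pattern SH = fs (fs (fs fz))
pattern TR = fs (fs (fs (fs fz)))
pattern s5 x = fs (fs (fs (fs (fs x))))
pattern Ch = s5 fz
pattern CH = s5 (fs fz)
pattern CZ = s5 (fs (fs fz))
pattern CR = s5 (fs (fs (fs fz)))
pattern CS = s5 (fs (fs (fs (fs fz))))
pattern A2 = s5 (fs (fs (fs (fs (fs fz)))))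
pattern A1 = s5 (fs (fs (fs (fs (fs (fs fz))))))
pattern A0 = s5 (fs (fs (fs (fs (fs (fs (fs fz)))))))
pattern M0 = s5 (fs (fs (fs (fs (fs (fs (fs (fs fz))))))))
pattern M1 = s5 (fs (fs (fs (fs (fs (fs (fs (fs (fs fz)))))))))
pattern M2 = s5 (fs (fs (fs (fs (fs (fs (fs (fs (fs (fs fz))))))))))

inputSym : Sym → Γ
inputSym s = s ↑ˡ 11

digitSym : ℤ₃ → Γ
digitSym fz = D0
digitSym (fs fz) = D1
digitSym (fs (fs fz)) = D2

centreSym : ℤ₃ → Γ
centreSym fz = M0
centreSym (fs fz) = M1
centreSym (fs (fs fz)) = M2

varSyms : ℕ → List Γ
varSyms m = A2 ∷ replicate m A1 ++ A0 ∷ []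

cubeSyms : ℤ₃ → ℕ → List Γ
cubeSyms (fs fz) m = varSyms m ++ varSyms m ++ varSyms m
cubeSyms fz m = []
cubeSyms (fs (fs fz)) m = []

data SymClass : Set where
  cDig cCont cCS cTR cCR cOther : SymClass

symClass : Γ → SymClass
symClass D0 = cDig
symClass D1 = cDig
symClass D2 = cDig
symClass TR = cTR
symClass CR = cCR
symClass CS = cCS
symClass A2 = cCont
symClass A1 = cCont
symClass A0 = cCont
symClass M0 = cCont
symClass M1 = cCont
symClass M2 = cCont
symClass _ = cOther

digitValue : Γ → ℤ₃
digitValue D1 = fs fz
digitValue D2 = fs (fs fz)
digitValue _ = fz

extendSyms : ℤ₃ → Γ → List Γ
extendSyms e A2 = A2 ∷ A1 ∷ []
extendSyms e M0 = cubeSyms e 0 ++ M0 ∷ cubeSyms e 0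
extendSyms e M1 = cubeSyms e 0 ++ M1 ∷ cubeSyms e 0
extendSyms e M2 = cubeSyms e 0 ++ M2 ∷ cubeSyms e 0
extendSyms e x = x ∷ []

encα : ℤ₃ → List Γ
encα c = map inputSym (encLetter {0} (cst (αᴳ c)))

encI : List Γ
encI = map inputSym (encLetter {0} (cst 𝐈ᴳ))

outputSyms : Γ → List Γ
outputSyms A2 = D2 ∷ []
outputSyms A1 = D1 ∷ []
outputSyms A0 = D0 ∷ []
outputSyms M0 = encα fz
outputSyms M1 = encα (fs fz)
outputSyms M2 = encα (fs (fs fz))
outputSyms _ = []

-- Init, S0, S1, S2 turn the input into the first sweep, Hd0 and HdR advance the header, Blk,
-- Cp, Dig, DigC and Act process a polynomial block, and Fn0, FnH, FnB, FnW translate the final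
-- queue into the output.  The Bool flags record whether the current digit is a coefficient,
-- whether the next header is fresh, and whether some block still had digits.
data State : Set where
  Init S0 S1 S2 : State
  Hd0 : Bool → State
  HdR : Bool → Bool → State
  Blk Cp : Bool → Bool → Bool → State
  Dig : Bool → Bool → ℤ₃ → State
  Act DigC : Bool → ℤ₃ → State
  Fn0 : Bool → State
  FnH FnB FnW Halt : State

Action : Set
Action = Maybe (State × List Γ)

copyTo : State → Γ → Action
copyTo q x = just (q , x ∷ [])

δ-S2 : Γ → SymClass → Action
δ-S2 x cCR = just (Hd0 false , x ∷ [])
δ-S2 x _ = copyTo S2 x

δ-Blk : Bool → Bool → Bool → Γ → SymClass → Action
δ-Blk c p g x cDig = just (Dig c p (digitValue x) , [])
δ-Blk c p true x cCR = just (Hd0 p , x ∷ [])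
δ-Blk c p false x cCR = just (Fn0 p , x ∷ [])
δ-Blk c p g x cTR = copyTo (Blk c p g) x
δ-Blk c p g x _ = copyTo (Cp c p g) x

δ-Cp : Bool → Bool → Bool → Γ → SymClass → Action
δ-Cp c p g x cTR = copyTo (Blk c p g) x
δ-Cp c p g x _ = copyTo (Cp c p g) x

δ-Dig : Bool → Bool → ℤ₃ → Γ → SymClass → Action
δ-Dig true p e x cCS = just (DigC p e , [])
δ-Dig false p e x cCS = copyTo (Act p e) x
δ-Dig true p e x cTR = just (Blk true p true , CS ∷ centreSym e ∷ TR ∷ [])
δ-Dig false p e x cTR = copyTo (Blk false p true) x
δ-Dig c p e x _ = copyTo (Dig c p e) x

δ-DigC : Bool → ℤ₃ → Γ → SymClass → Action
δ-DigC p e x cTR = just (Blk true p true , CS ∷ centreSym e ∷ TR ∷ [])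
δ-DigC p e x _ = copyTo (DigC p e) x

δ-Act : Bool → ℤ₃ → Γ → SymClass → Action
δ-Act p e x cTR = copyTo (Blk false p true) x
δ-Act p e x _ = just (Act p e , extendSyms e x)

δ-FnB : Γ → SymClass → Action
δ-FnB x cTR = just (FnB , encI ++ TR ∷ [])
δ-FnB x cCR = just (Halt , [])
δ-FnB x _ = just (FnW , outputSyms x)

δ-FnW : Γ → SymClass → Action
δ-FnW x cTR = copyTo FnB x
δ-FnW x _ = just (FnW , outputSyms x)

transition : State → Γ → Action
transition Init D1 = just (S0 , CR ∷ [])
transition Init SH = just (S1 , CR ∷ CH ∷ [])
transition Init _ = nothing
transition S0 D1 = just (S0 , [])
transition S0 SH = just (S1 , CH ∷ [])
transition S0 _ = nothing
transition S1 D1 = just (S1 , Ch ∷ [])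
transition S1 SH = just (S2 , CZ ∷ [])
transition S1 _ = nothing
transition S2 x = δ-S2 x (symClass x)
transition (Hd0 p) CH = just (HdR true true , Ch ∷ [])
transition (Hd0 p) Ch = just (HdR p p , Ch ∷ [])
transition (Hd0 p) _ = nothing
transition (HdR c true) Ch = just (HdR c false , CH ∷ [])
transition (HdR c false) Ch = just (HdR c false , Ch ∷ [])
transition (HdR c k) CH = just (HdR c true , Ch ∷ [])
transition (HdR c k) CZ = just (Blk c k false , CZ ∷ [])
transition (HdR c k) _ = nothing
transition (Blk c p g) x = δ-Blk c p g x (symClass x)
transition (Cp c p g) x = δ-Cp c p g x (symClass x)
transition (Dig c p e) x = δ-Dig c p e x (symClass x)
transition (Act p e) x = δ-Act p e x (symClass x)
transition (DigC p e) x = δ-DigC p e x (symClass x)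
transition (Fn0 p) CH = just (FnH , [])
transition (Fn0 true) Ch = just (FnH , [])
transition (Fn0 false) Ch = just (FnH , D1 ∷ [])
transition (Fn0 p) _ = nothing
transition FnH Ch = just (FnH , D1 ∷ [])
transition FnH CH = just (FnH , [])
transition FnH CZ = just (FnB , SH ∷ [])
transition FnH _ = nothing
transition FnB x = δ-FnB x (symClass x)
transition FnW x = δ-FnW x (symClass x)
transition Halt _ = nothing

-- Pass q xs q′ o: reading all of xs from state q ends in q′ having appended o.
data Pass : State → List Γ → State → List Γ → Set where
  tnil : ∀ {q} → Pass q [] q []
  tcons : ∀ {q x q1 u xs q2 o} → transition q x ≡ just (q1 , u) → Pass q1 xs q2 o → Pass q (x ∷ xs) q2 (u ++ o)

Pass-++ : ∀ {q xs q1 o1 ys q2 o2} → Pass q xs q1 o1 → Pass q1 ys q2 o2 → Pass q (xs ++ ys) q2 (o1 ++ o2)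
Pass-++ tnil t2 = t2
Pass-++ {o2 = o2} (tcons {u = u} {o = o} e t1) t2 = subst (Pass _ _ _) (sym (LP.++-assoc u o o2)) (tcons e (Pass-++ t1 t2))

Pass-one : ∀ {q x q1 u} → transition q x ≡ just (q1 , u) → Pass q (x ∷ []) q1 u
Pass-one {u = u} e = subst (Pass _ _ _) (LP.++-identityʳ u) (tcons e tnil)

Pass-output : ∀ {q xs q' o o'} → o ≡ o' → Pass q xs q' o → Pass q xs q' o'
Pass-output refl t = t

-- Sweeps over the polynomial blocks

ListTerm : Set
ListTerm = ℤ₃ × List ℤ₃

leftCubes : ℕ → List ℤ₃ → List Γ
leftCubes k [] = []
leftCubes k (e ∷ es) = cubeSyms e (k + length es) ++ leftCubes k es

rightCubes : ℕ → List ℤ₃ → List Γ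
rightCubes k [] = []
rightCubes k (e ∷ es) = rightCubes k es ++ cubeSyms e (k + length es)

termSyms : ListTerm → List Γ
termSyms (c , es) = leftCubes 0 es ++ centreSym c ∷ rightCubes 0 es

activeSyms : Maybe ListTerm → List Γ
activeSyms nothing = []
activeSyms (just t) = CS ∷ termSyms t

record Block : Set where
  constructor block
  field
    pending : List ℤ₃
    finished : List ListTerm
    active : Maybe ListTerm
open Block public

blockSyms : Block → List Γ
blockSyms (block r d a) = map digitSym r ++ concatMap termSyms d ++ activeSyms a ++ TR ∷ []

extendActive : ℤ₃ → Maybe ListTerm → Maybe ListTerm
extendActive e nothing = nothing
extendActive e (just (c , es)) = just (c , es ++ e ∷ [])

consumeDigit : Bool → Block → Block
consumeDigit c (block [] d a) = block [] d a
consumeDigit true (block (e ∷ r) d a) = block r (d ++ fromMaybe a) (just (e , []))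
consumeDigit false (block (e ∷ r) d a) = block r d (extendActive e a)

hasDigits : Block → Bool
hasDigits (block [] d a) = false
hasDigits (block (_ ∷ _) d a) = true

anyDigits : List Block → Bool
anyDigits [] = false
anyDigits (b ∷ bss) = hasDigits b ∨ anyDigits bss

IsContent : Γ → Set
IsContent x = symClass x ≡ cCont

Pass-copy : ∀ {q} {P : Γ → Set} → (∀ {x} → P x → transition q x ≡ copyTo q x) → ∀ {w} → All P w → Pass q w q w
Pass-copy h [] = tnil
Pass-copy h (px ∷ pw) = tcons (h px) (Pass-copy h pw)

allC-varSyms : ∀ m → All IsContent (varSyms m)
allC-varSyms m = refl ∷ AllP.++⁺ (rep m) (refl ∷ [])
  where
  rep : ∀ m → All IsContent (replicate m A1)
  rep zero = []
  rep (suc m) = refl ∷ rep m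

allC-cubeSyms : ∀ e m → All IsContent (cubeSyms e m)
allC-cubeSyms fz m = []
allC-cubeSyms (fs fz) m = AllP.++⁺ (allC-varSyms m) (AllP.++⁺ (allC-varSyms m) (allC-varSyms m))
allC-cubeSyms (fs (fs fz)) m = []

allC-leftCubes : ∀ k es → All IsContent (leftCubes k es)
allC-leftCubes k [] = []
allC-leftCubes k (e ∷ es) = AllP.++⁺ (allC-cubeSyms e _) (allC-leftCubes k es)

allC-rightCubes : ∀ k es → All IsContent (rightCubes k es)
allC-rightCubes k [] = []
allC-rightCubes k (e ∷ es) = AllP.++⁺ (allC-rightCubes k es) (allC-cubeSyms e _)

isContent-centreSym : ∀ c → IsContent (centreSym c)
isContent-centreSym fz = refl
isContent-centreSym (fs fz) = refl
isContent-centreSym (fs (fs fz)) = refl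

allC-termSyms : ∀ t → All IsContent (termSyms t)
allC-termSyms (c , es) = AllP.++⁺ (allC-leftCubes 0 es) (isContent-centreSym c ∷ allC-rightCubes 0 es)

allC-termSymss : ∀ d → All IsContent (concatMap termSyms d)
allC-termSymss [] = []
allC-termSymss (t ∷ d) = AllP.++⁺ (allC-termSyms t) (allC-termSymss d)

IsDigit : Γ → Set
IsDigit x = symClass x ≡ cDig

allDigit : ∀ r → All IsDigit (map digitSym r)
allDigit [] = []
allDigit (fz ∷ r) = refl ∷ allDigit r
allDigit (fs fz ∷ r) = refl ∷ allDigit r
allDigit (fs (fs fz) ∷ r) = refl ∷ allDigit r

Cp-C : ∀ {c p g x} → IsContent x → transition (Cp c p g) x ≡ copyTo (Cp c p g) x
Cp-C {x = x} h rewrite h = refl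

Dig-C : ∀ {c p e x} → IsContent x → transition (Dig c p e) x ≡ copyTo (Dig c p e) x
Dig-C {c} {x = x} h rewrite h with c
... | true = refl
... | false = refl

Dig-D : ∀ {c p e x} → IsDigit x → transition (Dig c p e) x ≡ copyTo (Dig c p e) x
Dig-D {c} {x = x} h rewrite h with c
... | true = refl
... | false = refl

DigC-C : ∀ {p e x} → IsContent x → transition (DigC p e) x ≡ copyTo (DigC p e) x
DigC-C {x = x} h rewrite h = refl

extend-varSyms : ∀ {p e} m → Pass (Act p e) (varSyms m) (Act p e) (varSyms (suc m))
extend-varSyms {p} {e} m = tcons refl (Pass-++ (Pass-copy (λ { {A1} refl → refl }) (rep m)) (Pass-one refl))
  where
  rep : ∀ m → All (_≡ A1) (replicate m A1)
  rep zero = []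
  rep (suc m) = refl ∷ rep m

extend-cubeSyms : ∀ {p e} f m → Pass (Act p e) (cubeSyms f m) (Act p e) (cubeSyms f (suc m))
extend-cubeSyms fz m = tnil
extend-cubeSyms (fs fz) m = Pass-++ (extend-varSyms m) (Pass-++ (extend-varSyms m) (extend-varSyms m))
extend-cubeSyms (fs (fs fz)) m = tnil

extend-leftCubes : ∀ {p e} k es → Pass (Act p e) (leftCubes k es) (Act p e) (leftCubes (suc k) es)
extend-leftCubes k [] = tnil
extend-leftCubes k (f ∷ es) = Pass-++ (extend-cubeSyms f (k + length es)) (extend-leftCubes k es)

extend-rightCubes : ∀ {p e} k es → Pass (Act p e) (rightCubes k es) (Act p e) (rightCubes (suc k) es)
extend-rightCubes k [] = tnil
extend-rightCubes k (f ∷ es) = Pass-++ (extend-rightCubes k es) (extend-cubeSyms f (k + length es))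

extend-centreSym : ∀ {p e} c → Pass (Act p e) (centreSym c ∷ []) (Act p e) (cubeSyms e 0 ++ centreSym c ∷ cubeSyms e 0)
extend-centreSym fz = Pass-one refl
extend-centreSym (fs fz) = Pass-one refl
extend-centreSym (fs (fs fz)) = Pass-one refl

len-snoc : ∀ k (xs : List ℤ₃) e → k + length (xs ++ e ∷ []) ≡ suc (k + length xs)
len-snoc k xs e = trans (cong (k +_) (trans (LP.length-++ xs) (+-comm (length xs) 1))) (+-suc k (length xs))

leftCubes-snoc : ∀ k es e → leftCubes (suc k) es ++ cubeSyms e k ≡ leftCubes k (es ++ e ∷ [])
leftCubes-snoc k [] e = sym (trans (LP.++-identityʳ (cubeSyms e (k + 0))) (cong (cubeSyms e) (+-identityʳ k)))
leftCubes-snoc k (x ∷ xs) e = begin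
    (cubeSyms x (suc k + length xs) ++ leftCubes (suc k) xs) ++ cubeSyms e k ≡⟨ LP.++-assoc (cubeSyms x _) _ _ ⟩
    cubeSyms x (suc k + length xs) ++ (leftCubes (suc k) xs ++ cubeSyms e k) ≡⟨ cong₂ _++_ (cong (cubeSyms x) (sym (len-snoc k xs e))) (leftCubes-snoc k xs e) ⟩
    cubeSyms x (k + length (xs ++ e ∷ [])) ++ leftCubes k (xs ++ e ∷ []) ∎
  where open ≡-Reasoning

rightCubes-snoc : ∀ k es e → cubeSyms e k ++ rightCubes (suc k) es ≡ rightCubes k (es ++ e ∷ [])
rightCubes-snoc k [] e = trans (LP.++-identityʳ (cubeSyms e k)) (cong (cubeSyms e) (sym (+-identityʳ k)))
rightCubes-snoc k (x ∷ xs) e = begin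
    cubeSyms e k ++ (rightCubes (suc k) xs ++ cubeSyms x (suc k + length xs)) ≡⟨ sym (LP.++-assoc (cubeSyms e k) _ _) ⟩
    (cubeSyms e k ++ rightCubes (suc k) xs) ++ cubeSyms x (suc k + length xs) ≡⟨ cong₂ _++_ (rightCubes-snoc k xs e) (cong (cubeSyms x) (sym (len-snoc k xs e))) ⟩
    rightCubes k (xs ++ e ∷ []) ++ cubeSyms x (k + length (xs ++ e ∷ [])) ∎
  where open ≡-Reasoning

extend-termSyms : ∀ {p} e c es → Pass (Act p e) (termSyms (c , es)) (Act p e) (termSyms (c , es ++ e ∷ []))
extend-termSyms e c es = Pass-output eq (Pass-++ (extend-leftCubes 0 es) (Pass-++ (extend-centreSym c) (extend-rightCubes 0 es)))
  where
  eq : leftCubes 1 es ++ (cubeSyms e 0 ++ centreSym c ∷ cubeSyms e 0) ++ rightCubes 1 es ≡ termSyms (c , es ++ e ∷ [])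
  eq = begin
      leftCubes 1 es ++ (cubeSyms e 0 ++ centreSym c ∷ cubeSyms e 0) ++ rightCubes 1 es ≡⟨ cong (leftCubes 1 es ++_) (LP.++-assoc (cubeSyms e 0) _ _) ⟩
      leftCubes 1 es ++ cubeSyms e 0 ++ centreSym c ∷ cubeSyms e 0 ++ rightCubes 1 es ≡⟨ sym (LP.++-assoc (leftCubes 1 es) _ _) ⟩
      (leftCubes 1 es ++ cubeSyms e 0) ++ centreSym c ∷ cubeSyms e 0 ++ rightCubes 1 es ≡⟨ cong₂ (λ u v → u ++ centreSym c ∷ v) (leftCubes-snoc 0 es e) (rightCubes-snoc 0 es e) ⟩
      termSyms (c , es ++ e ∷ []) ∎
    where open ≡-Reasoning

Blk-C : ∀ {c p g x} → IsContent x → transition (Blk c p g) x ≡ copyTo (Cp c p g) x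
Blk-C {x = x} h rewrite h = refl

blockSyms-idle : ∀ {c p g} w → All IsContent w → ∀ a → Pass (Blk c p g) (w ++ activeSyms a ++ TR ∷ []) (Blk c p g) (w ++ activeSyms a ++ TR ∷ [])
blockSyms-idle [] [] nothing = Pass-one refl
blockSyms-idle [] [] (just t) = tcons refl (Pass-++ (Pass-copy Cp-C (allC-termSyms t)) (Pass-one refl))
blockSyms-idle (x ∷ w) (px ∷ pw) a = tcons (Blk-C px) (Pass-++ (Pass-copy Cp-C pw) (tail a))
  where
  tail : ∀ a → Pass (Cp _ _ _) (activeSyms a ++ TR ∷ []) (Blk _ _ _) (activeSyms a ++ TR ∷ [])
  tail nothing = Pass-one refl
  tail (just t) = tcons refl (Pass-++ (Pass-copy Cp-C (allC-termSyms t)) (Pass-one refl))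

Blk-digitSym : ∀ {c p g} e → transition (Blk c p g) (digitSym e) ≡ just (Dig c p e , [])
Blk-digitSym fz = refl
Blk-digitSym (fs fz) = refl
Blk-digitSym (fs (fs fz)) = refl

blockSyms-round : ∀ c p g b → Pass (Blk c p g) (blockSyms b) (Blk c p (hasDigits b ∨ g)) (blockSyms (consumeDigit c b))
blockSyms-round c p g (block [] d a) = blockSyms-idle (concatMap termSyms d) (allC-termSymss d) a
blockSyms-round true p g (block (e ∷ r) d a) = tcons (Blk-digitSym e) (Pass-output eq (Pass-++ (Pass-copy Dig-D (allDigit r)) (Pass-++ (Pass-copy Dig-C (allC-termSymss d)) (tl a))))
  where
  tl : ∀ a → Pass (Dig true p e) (activeSyms a ++ TR ∷ []) (Blk true p true) (concatMap termSyms (fromMaybe a) ++ CS ∷ centreSym e ∷ TR ∷ [])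
  tl nothing = Pass-one refl
  tl (just t) = Pass-output (cong (_++ CS ∷ centreSym e ∷ TR ∷ []) (sym (LP.++-identityʳ (termSyms t)))) (tcons refl (Pass-++ (Pass-copy DigC-C (allC-termSyms t)) (Pass-one refl)))
  eq : map digitSym r ++ concatMap termSyms d ++ concatMap termSyms (fromMaybe a) ++ CS ∷ centreSym e ∷ TR ∷ [] ≡ blockSyms (consumeDigit true (block (e ∷ r) d a))
  eq = cong (map digitSym r ++_) (trans (sym (LP.++-assoc (concatMap termSyms d) _ _))
         (cong (_++ CS ∷ centreSym e ∷ TR ∷ []) (sym (LP.concatMap-++ termSyms d (fromMaybe a)))))
blockSyms-round false p g (block (e ∷ r) d a) = tcons (Blk-digitSym e) (Pass-++ (Pass-copy Dig-D (allDigit r)) (Pass-++ (Pass-copy Dig-C (allC-termSymss d)) (tl a)))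
  where
  tl : ∀ a → Pass (Dig false p e) (activeSyms a ++ TR ∷ []) (Blk false p true) (activeSyms (extendActive e a) ++ TR ∷ [])
  tl nothing = Pass-one refl
  tl (just (c , es)) = tcons refl (Pass-++ (extend-termSyms e c es) (Pass-one refl))

swap∨ : ∀ a b c → a ∨ (b ∨ c) ≡ (b ∨ a) ∨ c
swap∨ true true c = refl
swap∨ true false c = refl
swap∨ false true c = refl
swap∨ false false c = refl

blocksSyms-round : ∀ c p g bss → Pass (Blk c p g) (concatMap blockSyms bss) (Blk c p (anyDigits bss ∨ g)) (concatMap blockSyms (map (consumeDigit c) bss))
blocksSyms-round c p g [] = tnil
blocksSyms-round c p g (b ∷ bss) = subst (λ h → Pass (Blk c p g) _ (Blk c p h) _) (swap∨ (anyDigits bss) (hasDigits b) g)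
  (Pass-++ (blockSyms-round c p g b) (blocksSyms-round c p (hasDigits b ∨ g) bss))

-- The header Ch^m CH Ch^k CZ (m + k = n) marks the position inside the current term; the
-- next digit is a coefficient when m = 0 or the header is fresh.
data Header : Set where
  fresh : Header
  at : ℕ → ℕ → Header

headerSyms : ℕ → Header → List Γ
headerSyms n fresh = replicate (suc n) Ch ++ CZ ∷ []
headerSyms n (at m k) = replicate m Ch ++ CH ∷ replicate k Ch ++ CZ ∷ []

startHeader : ℕ → Header
startHeader zero = fresh
startHeader (suc n) = at 1 n

nextHeader : ℕ → Header → Header
nextHeader n fresh = startHeader n
nextHeader n (at m zero) = fresh
nextHeader n (at m (suc k)) = at (suc m) k

atCoefficient : Header → Bool
atCoefficient fresh = true
atCoefficient (at zero k) = true
atCoefficient (at (suc m) k) = false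

isFresh : Header → Bool
isFresh fresh = true
isFresh (at m k) = false

Valid : ℕ → Header → Set
Valid n fresh = ⊤
Valid n (at m k) = m + k ≡ n

replicate-snoc : ∀ {A : Set} m (x : A) ys → replicate m x ++ x ∷ ys ≡ x ∷ replicate m x ++ ys
replicate-snoc zero x ys = refl
replicate-snoc (suc m) x ys = cong (x ∷_) (replicate-snoc m x ys)

copy-HdR : ∀ c j → Pass (HdR c false) (replicate j Ch) (HdR c false) (replicate j Ch)
copy-HdR c zero = tnil
copy-HdR c (suc j) = tcons refl (copy-HdR c j)

header-round : ∀ n h → Valid n h → Pass (Hd0 (isFresh h)) (headerSyms n h) (Blk (atCoefficient h) (isFresh (nextHeader n h)) false) (headerSyms n (nextHeader n h))
header-round zero fresh v = tcons refl (Pass-one refl)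
header-round (suc n) fresh v = tcons refl (tcons refl (Pass-++ (copy-HdR true n) (Pass-one refl)))
header-round .(zero + zero) (at zero zero) refl = tcons refl (Pass-one refl)
header-round .(zero + suc k) (at zero (suc k)) refl = tcons refl (tcons refl (Pass-++ (copy-HdR true k) (Pass-one refl)))
header-round .(suc m + zero) (at (suc m) zero) refl =
  Pass-output eq (tcons refl (Pass-++ (copy-HdR false m) (tcons refl (Pass-one refl))))
  where
  eq : Ch ∷ replicate m Ch ++ Ch ∷ CZ ∷ [] ≡ headerSyms (suc m + zero) fresh
  eq = cong (Ch ∷_) (trans (replicate-snoc m Ch (CZ ∷ [])) (cong (λ z → replicate (suc z) Ch ++ CZ ∷ []) (sym (+-identityʳ m))))
header-round .(suc m + suc k) (at (suc m) (suc k)) refl =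
  Pass-output eq (tcons refl (Pass-++ (copy-HdR false m) (tcons refl (tcons refl (Pass-++ (copy-HdR false k) (Pass-one refl))))))
  where
  eq : Ch ∷ replicate m Ch ++ Ch ∷ CH ∷ replicate k Ch ++ CZ ∷ [] ≡ headerSyms (suc m + suc k) (at (suc (suc m)) k)
  eq = cong (Ch ∷_) (replicate-snoc m Ch _)

afterBlocks : Bool → Bool → State
afterBlocks true p = Hd0 p
afterBlocks false p = Fn0 p

roundTape : ℕ → Header → List Block → List Γ
roundTape n h bss = headerSyms n h ++ concatMap blockSyms bss ++ CR ∷ []

round-pass : ∀ n h bss → Valid n h →
        Pass (Hd0 (isFresh h)) (roundTape n h bss) (afterBlocks (anyDigits bss) (isFresh (nextHeader n h))) (roundTape n (nextHeader n h) (map (consumeDigit (atCoefficient h)) bss))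
round-pass n h bss v = Pass-++ (header-round n h v) (Pass-++ (blocksSyms-round (atCoefficient h) (isFresh (nextHeader n h)) false bss) (last (anyDigits bss)))
  where
  last : ∀ g → Pass (Blk (atCoefficient h) (isFresh (nextHeader n h)) (g ∨ false)) (CR ∷ []) (afterBlocks g (isFresh (nextHeader n h))) (CR ∷ [])
  last true = Pass-one refl
  last false = Pass-one refl

copy-FnH : ∀ j → Pass FnH (replicate j Ch) FnH (replicate j D1)
copy-FnH zero = tnil
copy-FnH (suc j) = tcons refl (copy-FnH j)

replicate-++ : ∀ {A : Set} m k (x : A) ys → replicate m x ++ replicate k x ++ ys ≡ replicate (m + k) x ++ ys
replicate-++ zero k x ys = refl
replicate-++ (suc m) k x ys = cong (x ∷_) (replicate-++ m k x ys)

final-header : ∀ n h → Valid n h → Pass (Fn0 (isFresh h)) (headerSyms n h) FnB (replicate n D1 ++ SH ∷ [])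
final-header n fresh v = tcons refl (Pass-++ (copy-FnH n) (Pass-one refl))
final-header .(zero + k) (at zero k) refl = tcons refl (Pass-++ (copy-FnH k) (Pass-one refl))
final-header .(suc m + k) (at (suc m) k) refl =
  Pass-output (cong (D1 ∷_) (replicate-++ m k D1 (SH ∷ []))) (tcons refl (Pass-++ (copy-FnH m) (tcons refl (Pass-++ (copy-FnH k) (Pass-one refl)))))

Translatable : Γ → Set
Translatable x = (symClass x ≡ cCont) ⊎ (symClass x ≡ cCS)

FnB-ok : ∀ {x} → Translatable x → transition FnB x ≡ just (FnW , outputSyms x)
FnB-ok {x} (inj₁ h) rewrite h = refl
FnB-ok {x} (inj₂ h) rewrite h = refl

FnW-ok : ∀ {x} → Translatable x → transition FnW x ≡ just (FnW , outputSyms x)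
FnW-ok {x} (inj₁ h) rewrite h = refl
FnW-ok {x} (inj₂ h) rewrite h = refl

final-FnW : ∀ w → All Translatable w → Pass FnW w FnW (concatMap outputSyms w)
final-FnW [] [] = tnil
final-FnW (x ∷ w) (px ∷ pw) = tcons (FnW-ok px) (final-FnW w pw)

finalBlockSyms : List Γ → List Γ
finalBlockSyms [] = encI ++ TR ∷ []
finalBlockSyms (y ∷ ys) = concatMap outputSyms (y ∷ ys) ++ TR ∷ []

final-content : ∀ w → All Translatable w → Pass FnB (w ++ TR ∷ []) FnB (finalBlockSyms w)
final-content [] [] = Pass-one refl
final-content (y ∷ ys) (py ∷ pys) = Pass-output (sym (LP.++-assoc (outputSyms y) _ _)) (tcons (FnB-ok py) (Pass-++ (final-FnW ys pys) (Pass-one refl)))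

termOutput : ListTerm → List Γ
termOutput t = concatMap outputSyms (termSyms t)

wordOutput : List ListTerm → List Γ
wordOutput [] = encI ++ TR ∷ []
wordOutput (t ∷ ts) = concatMap termOutput (t ∷ ts) ++ TR ∷ []

translatable-content : ∀ {w} → All IsContent w → All Translatable w
translatable-content [] = []
translatable-content (p ∷ ps) = inj₁ p ∷ translatable-content ps

contentSyms : Block → List Γ
contentSyms b = concatMap termSyms (finished b) ++ activeSyms (active b)

translatable-contentSyms : ∀ b → All Translatable (contentSyms b)
translatable-contentSyms (block r d nothing) = AllP.++⁺ (translatable-content (allC-termSymss d)) []
translatable-contentSyms (block r d (just t)) = AllP.++⁺ (translatable-content (allC-termSymss d)) (inj₂ refl ∷ translatable-content (allC-termSyms t))

concatMap-outputSyms : ∀ d a → concatMap outputSyms (concatMap termSyms d ++ activeSyms a) ≡ concatMap termOutput (d ++ fromMaybe a)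
concatMap-outputSyms [] nothing = refl
concatMap-outputSyms [] (just t) = sym (LP.++-identityʳ (termOutput t))
concatMap-outputSyms (t ∷ d) a = begin
    concatMap outputSyms ((termSyms t ++ concatMap termSyms d) ++ activeSyms a) ≡⟨ cong (concatMap outputSyms) (LP.++-assoc (termSyms t) _ _) ⟩
    concatMap outputSyms (termSyms t ++ (concatMap termSyms d ++ activeSyms a)) ≡⟨ LP.concatMap-++ outputSyms (termSyms t) _ ⟩
    termOutput t ++ concatMap outputSyms (concatMap termSyms d ++ activeSyms a) ≡⟨ cong (termOutput t ++_) (concatMap-outputSyms d a) ⟩
    termOutput t ++ concatMap termOutput (d ++ fromMaybe a) ∎
  where open ≡-Reasoning

termSyms-nonEmpty : ∀ t → Σ Γ (λ y → Σ (List Γ) (λ ys → termSyms t ≡ y ∷ ys))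
termSyms-nonEmpty (c , es) with leftCubes 0 es
... | [] = centreSym c , rightCubes 0 es , refl
... | y ∷ ys = y , ys ++ centreSym c ∷ rightCubes 0 es , refl

finalBlockSyms-contentSyms : ∀ d a → finalBlockSyms (concatMap termSyms d ++ activeSyms a) ≡ wordOutput (d ++ fromMaybe a)
finalBlockSyms-contentSyms [] nothing = refl
finalBlockSyms-contentSyms [] (just t) = cong (_++ TR ∷ []) (concatMap-outputSyms [] (just t))
finalBlockSyms-contentSyms (t ∷ d) a with termSyms-nonEmpty t
... | y , ys , eq = begin
      finalBlockSyms ((termSyms t ++ concatMap termSyms d) ++ activeSyms a) ≡⟨ cong (λ z → finalBlockSyms ((z ++ concatMap termSyms d) ++ activeSyms a)) eq ⟩
      finalBlockSyms (((y ∷ ys) ++ concatMap termSyms d) ++ activeSyms a) ≡⟨⟩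
      concatMap outputSyms (((y ∷ ys) ++ concatMap termSyms d) ++ activeSyms a) ++ TR ∷ []
        ≡⟨ cong (λ z → concatMap outputSyms ((z ++ concatMap termSyms d) ++ activeSyms a) ++ TR ∷ []) (sym eq) ⟩
      concatMap outputSyms (concatMap termSyms (t ∷ d) ++ activeSyms a) ++ TR ∷ [] ≡⟨ cong (_++ TR ∷ []) (concatMap-outputSyms (t ∷ d) a) ⟩
      wordOutput ((t ∷ d) ++ fromMaybe a) ∎
  where open ≡-Reasoning

final-block : ∀ d a → Pass FnB (blockSyms (block [] d a)) FnB (wordOutput (d ++ fromMaybe a))
final-block d a = Pass-output (finalBlockSyms-contentSyms d a)
  (subst (λ z → Pass FnB z FnB (finalBlockSyms (contentSyms (block [] d a)))) (LP.++-assoc (concatMap termSyms d) (activeSyms a) (TR ∷ []))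
    (final-content (contentSyms (block [] d a)) (translatable-contentSyms (block [] d a))))

blockOutput : Block → List Γ
blockOutput b = wordOutput (finished b ++ fromMaybe (active b))

Idle : Block → Set
Idle b = pending b ≡ []

final-blocks : ∀ bss → All Idle bss → Pass FnB (concatMap blockSyms bss) FnB (concatMap blockOutput bss)
final-blocks [] [] = tnil
final-blocks (block .[] d a ∷ bss) (refl ∷ ps) = Pass-++ (final-block d a) (final-blocks bss ps)

final-pass : ∀ n h bss → Valid n h → All Idle bss →
           Pass (Fn0 (isFresh h)) (roundTape n h bss) Halt (replicate n D1 ++ SH ∷ concatMap blockOutput bss)
final-pass n h bss v ps = Pass-output eq (Pass-++ (final-header n h v) (Pass-++ (final-blocks bss ps) (Pass-one refl)))
  where
  eq : (replicate n D1 ++ SH ∷ []) ++ concatMap blockOutput bss ++ [] ≡ replicate n D1 ++ SH ∷ concatMap blockOutput bss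
  eq = trans (LP.++-assoc (replicate n D1) _ _) (cong (λ z → replicate n D1 ++ SH ∷ z) (LP.++-identityʳ _))

initialBlock : List ℤ₃ → Block
initialBlock D = block D [] nothing

digitBlocks : List (List ℤ₃) → List Γ
digitBlocks = concatMap (λ D → map digitSym D ++ TR ∷ [])

copyS0 : ∀ j → Pass S0 (replicate j D1) S0 []
copyS0 zero = tnil
copyS0 (suc j) = tcons refl (copyS0 j)

copyS1 : ∀ j → Pass S1 (replicate j D1) S1 (replicate j Ch)
copyS1 zero = tnil
copyS1 (suc j) = tcons refl (copyS1 j)

S2-D : ∀ {x} → IsDigit x → transition S2 x ≡ copyTo S2 x
S2-D {x} h rewrite h = refl

copyS2 : ∀ Ds → Pass S2 (digitBlocks Ds) S2 (concatMap blockSyms (map initialBlock Ds))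
copyS2 [] = tnil
copyS2 (D ∷ Ds) = Pass-++ (Pass-++ (Pass-copy S2-D (allDigit D)) (Pass-one refl)) (copyS2 Ds)

header-pass : ∀ n Ds → Pass S1 (replicate n D1 ++ SH ∷ digitBlocks Ds) S2
                             ((replicate n Ch ++ CZ ∷ []) ++ concatMap blockSyms (map initialBlock Ds))
header-pass n Ds = Pass-output (sym (LP.++-assoc (replicate n Ch) _ _)) (Pass-++ (copyS1 n) (tcons refl (copyS2 Ds)))

initial-pass : ∀ k n Ds → Pass Init (replicate k D1 ++ SH ∷ replicate n D1 ++ SH ∷ digitBlocks Ds)
                     S2 (CR ∷ headerSyms n (at 0 n) ++ concatMap blockSyms (map initialBlock Ds))
initial-pass zero n Ds = tcons refl (header-pass n Ds)
initial-pass (suc k) n Ds = tcons refl (Pass-++ (copyS0 k) (tcons refl (header-pass n Ds)))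

-- A Turing machine simulating the automaton

stateCount : ℕ
stateCount = 56

encQ : State → Fin stateCount
encQ Init = # 0
encQ S0 = # 1
encQ S1 = # 2
encQ S2 = # 3
encQ (Hd0 true) = # 4
encQ (Hd0 false) = # 5
encQ (HdR true true) = # 6
encQ (HdR true false) = # 7
encQ (HdR false true) = # 8
encQ (HdR false false) = # 9
encQ (Blk true true true) = # 10
encQ (Blk true true false) = # 11
encQ (Blk true false true) = # 12
encQ (Blk true false false) = # 13
encQ (Blk false true true) = # 14
encQ (Blk false true false) = # 15
encQ (Blk false false true) = # 16
encQ (Blk false false false) = # 17
encQ (Cp true true true) = # 18
encQ (Cp true true false) = # 19
encQ (Cp true false true) = # 20
encQ (Cp true false false) = # 21
encQ (Cp false true true) = # 22
encQ (Cp false true false) = # 23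
encQ (Cp false false true) = # 24
encQ (Cp false false false) = # 25
encQ (Dig true true fz) = # 26
encQ (Dig true true (fs fz)) = # 27
encQ (Dig true true (fs (fs fz))) = # 28
encQ (Dig true false fz) = # 29
encQ (Dig true false (fs fz)) = # 30
encQ (Dig true false (fs (fs fz))) = # 31
encQ (Dig false true fz) = # 32
encQ (Dig false true (fs fz)) = # 33
encQ (Dig false true (fs (fs fz))) = # 34
encQ (Dig false false fz) = # 35
encQ (Dig false false (fs fz)) = # 36
encQ (Dig false false (fs (fs fz))) = # 37
encQ (Act true fz) = # 38
encQ (Act true (fs fz)) = # 39
encQ (Act true (fs (fs fz))) = # 40
encQ (Act false fz) = # 41
encQ (Act false (fs fz)) = # 42
encQ (Act false (fs (fs fz))) = # 43
encQ (DigC true fz) = # 44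
encQ (DigC true (fs fz)) = # 45
encQ (DigC true (fs (fs fz))) = # 46
encQ (DigC false fz) = # 47
encQ (DigC false (fs fz)) = # 48
encQ (DigC false (fs (fs fz))) = # 49
encQ (Fn0 true) = # 50
encQ (Fn0 false) = # 51
encQ FnH = # 52
encQ FnB = # 53
encQ FnW = # 54
encQ Halt = # 55

allQ : Vec State stateCount
allQ =
  Init ∷ S0 ∷ S1 ∷ S2 ∷ (Hd0 true) ∷ (Hd0 false) ∷ (HdR true true) ∷ (HdR true false) ∷
  (HdR false true) ∷ (HdR false false) ∷ (Blk true true true) ∷ (Blk true true false) ∷
  (Blk true false true) ∷ (Blk true false false) ∷ (Blk false true true) ∷ (Blk false true false) ∷
  (Blk false false true) ∷ (Blk false false false) ∷ (Cp true true true) ∷ (Cp true true false) ∷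
  (Cp true false true) ∷ (Cp true false false) ∷ (Cp false true true) ∷ (Cp false true false) ∷
  (Cp false false true) ∷ (Cp false false false) ∷ (Dig true true fz) ∷ (Dig true true (fs fz)) ∷
  (Dig true true (fs (fs fz))) ∷ (Dig true false fz) ∷ (Dig true false (fs fz)) ∷ (Dig true false (fs (fs fz))) ∷
  (Dig false true fz) ∷ (Dig false true (fs fz)) ∷ (Dig false true (fs (fs fz))) ∷ (Dig false false fz) ∷
  (Dig false false (fs fz)) ∷ (Dig false false (fs (fs fz))) ∷ (Act true fz) ∷ (Act true (fs fz)) ∷
  (Act true (fs (fs fz))) ∷ (Act false fz) ∷ (Act false (fs fz)) ∷ (Act false (fs (fs fz))) ∷
  (DigC true fz) ∷ (DigC true (fs fz)) ∷ (DigC true (fs (fs fz))) ∷ (DigC false fz) ∷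
  (DigC false (fs fz)) ∷ (DigC false (fs (fs fz))) ∷ (Fn0 true) ∷ (Fn0 false) ∷ FnH ∷
  FnB ∷ FnW ∷ Halt ∷ []

decQ : Fin stateCount → State
decQ i = lookup allQ i

decQ-encQ : ∀ q → decQ (encQ q) ≡ q
decQ-encQ Init = refl
decQ-encQ S0 = refl
decQ-encQ S1 = refl
decQ-encQ S2 = refl
decQ-encQ (Hd0 true) = refl
decQ-encQ (Hd0 false) = refl
decQ-encQ (HdR true true) = refl
decQ-encQ (HdR true false) = refl
decQ-encQ (HdR false true) = refl
decQ-encQ (HdR false false) = refl
decQ-encQ (Blk true true true) = refl
decQ-encQ (Blk true true false) = refl
decQ-encQ (Blk true false true) = refl
decQ-encQ (Blk true false false) = refl
decQ-encQ (Blk false true true) = refl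
decQ-encQ (Blk false true false) = refl
decQ-encQ (Blk false false true) = refl
decQ-encQ (Blk false false false) = refl
decQ-encQ (Cp true true true) = refl
decQ-encQ (Cp true true false) = refl
decQ-encQ (Cp true false true) = refl
decQ-encQ (Cp true false false) = refl
decQ-encQ (Cp false true true) = refl
decQ-encQ (Cp false true false) = refl
decQ-encQ (Cp false false true) = refl
decQ-encQ (Cp false false false) = refl
decQ-encQ (Dig true true fz) = refl
decQ-encQ (Dig true true (fs fz)) = refl
decQ-encQ (Dig true true (fs (fs fz))) = refl
decQ-encQ (Dig true false fz) = refl
decQ-encQ (Dig true false (fs fz)) = refl
decQ-encQ (Dig true false (fs (fs fz))) = refl
decQ-encQ (Dig false true fz) = refl
decQ-encQ (Dig false true (fs fz)) = refl
decQ-encQ (Dig false true (fs (fs fz))) = refl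
decQ-encQ (Dig false false fz) = refl
decQ-encQ (Dig false false (fs fz)) = refl
decQ-encQ (Dig false false (fs (fs fz))) = refl
decQ-encQ (Act true fz) = refl
decQ-encQ (Act true (fs fz)) = refl
decQ-encQ (Act true (fs (fs fz))) = refl
decQ-encQ (Act false fz) = refl
decQ-encQ (Act false (fs fz)) = refl
decQ-encQ (Act false (fs (fs fz))) = refl
decQ-encQ (DigC true fz) = refl
decQ-encQ (DigC true (fs fz)) = refl
decQ-encQ (DigC true (fs (fs fz))) = refl
decQ-encQ (DigC false fz) = refl
decQ-encQ (DigC false (fs fz)) = refl
decQ-encQ (DigC false (fs (fs fz))) = refl
decQ-encQ (Fn0 true) = refl
decQ-encQ (Fn0 false) = refl
decQ-encQ FnH = refl
decQ-encQ FnB = refl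
decQ-encQ FnW = refl
decQ-encQ Halt = refl

-- A transition of the queue automaton on x is simulated by: Read x, Carry it right to the
-- first blank writing the emitted symbols (i counts those written), Return to the left end.
data TMState : Set where
  Read : State → TMState
  Carry : State → Γ → Fin 14 → TMState
  Return : State → TMState

carryCount : ℕ
carryCount = stateCount * (16 * 14)

tmStateCount : ℕ
tmStateCount = stateCount + (carryCount + stateCount)

encT : TMState → Fin tmStateCount
encT (Read q) = join stateCount (carryCount + stateCount) (inj₁ (encQ q))
encT (Carry q x i) = join stateCount (carryCount + stateCount) (inj₂ (join carryCount stateCount (inj₁ (combine (encQ q) (combine x i)))))
encT (Return q) = join stateCount (carryCount + stateCount) (inj₂ (join carryCount stateCount (inj₂ (encQ q))))

dCa : Fin stateCount × Fin (16 * 14) → TMState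
dCa (a , b) = Carry (decQ a) (proj₁ (remQuot {16} 14 b)) (proj₂ (remQuot {16} 14 b))

dRest : Fin (carryCount + stateCount) → TMState
dRest j = [ (λ k → dCa (remQuot {stateCount} (16 * 14) k)) , (λ k → Return (decQ k)) ]′ (splitAt carryCount j)

decT : Fin tmStateCount → TMState
decT f = [ (λ i → Read (decQ i)) , dRest ]′ (splitAt stateCount f)

decT-encT : ∀ s → decT (encT s) ≡ s
decT-encT (Read q) = trans (cong [ (λ i → Read (decQ i)) , dRest ]′ (FinP.splitAt-join stateCount (carryCount + stateCount) (inj₁ (encQ q)))) (cong Read (decQ-encQ q))
decT-encT (Carry q x i) =
  trans (cong [ (λ i → Read (decQ i)) , dRest ]′ (FinP.splitAt-join stateCount (carryCount + stateCount) (inj₂ (join carryCount stateCount (inj₁ cq)))))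
  (trans (cong [ (λ k → dCa (remQuot {stateCount} (16 * 14) k)) , (λ k → Return (decQ k)) ]′ (FinP.splitAt-join carryCount stateCount (inj₁ cq)))
  (trans (cong dCa (FinP.remQuot-combine {k = 16 * 14} (encQ q) (combine x i)))
  (trans (cong (λ z → Carry (decQ (encQ q)) (proj₁ z) (proj₂ z)) (FinP.remQuot-combine {k = 14} x i))
         (cong (λ z → Carry z x i) (decQ-encQ q)))))
  where
  cq = combine (encQ q) (combine x i)
decT-encT (Return q) =
  trans (cong [ (λ i → Read (decQ i)) , dRest ]′ (FinP.splitAt-join stateCount (carryCount + stateCount) (inj₂ (join carryCount stateCount (inj₂ (encQ q))))))
  (trans (cong [ (λ k → dCa (remQuot {stateCount} (16 * 14) k)) , (λ k → Return (decQ k)) ]′ (FinP.splitAt-join carryCount stateCount (inj₂ (encQ q))))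
         (cong Return (decQ-encQ q)))

emittedBy : Action → List Γ
emittedBy nothing = []
emittedBy (just (_ , u)) = u

nextStateBy : State → Action → State
nextStateBy q nothing = q
nextStateBy q (just (q1 , _)) = q1

emitted : State → Γ → List Γ
emitted q x = emittedBy (transition q x)

nextState : State → Γ → State
nextState q x = nextStateBy q (transition q x)

incF : ∀ {n} → Fin (suc n) → Fin (suc n)
incF {zero} fz = fz
incF {suc n} fz = fs fz
incF {suc n} (fs i) = fs (incF i)

toℕ-incF : ∀ {n} (i : Fin (suc n)) → toℕ i < n → toℕ (incF i) ≡ suc (toℕ i)
toℕ-incF {suc n} fz _ = refl
toℕ-incF {suc n} (fs i) (s≤s p) = cong suc (toℕ-incF i p)

Cell : Set
Cell = Maybe Γ

TMAction : Set
TMAction = Maybe (TMState × Cell × Move)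

δ-Read : State → Γ → Action → TMAction
δ-Read q x nothing = nothing
δ-Read q x (just _) = just (Carry q x fz , nothing , R)

δ-CarryEnd : State → Γ → Fin 14 → List Γ → TMAction
δ-CarryEnd q x i (y ∷ _) = just (Carry q x (incF i) , just y , R)
δ-CarryEnd q x i [] = just (Return (nextState q x) , nothing , L)

tmδ : TMState → Cell → TMAction
tmδ (Read q) nothing = nothing
tmδ (Read q) (just x) = δ-Read q x (transition q x)
tmδ (Carry q x i) (just y) = just (Carry q x i , just y , R)
tmδ (Carry q x i) nothing = δ-CarryEnd q x i (drop (toℕ i) (emitted q x))
tmδ (Return q) (just y) = just (Return q , just y , L)
tmδ (Return q) nothing = just (Read q , nothing , R)

encodeAction : TMAction → Maybe (Fin tmStateCount × Cell × Move)
encodeAction nothing = nothing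
encodeAction (just (s , w , m)) = just (encT s , w , m)

-- 12655 = tmStateCount ∸ 1, and the 11 auxiliary symbols complete the 5 input symbols to Γ.
machine : TM
machine = record { states = 12655 ; aux = 11 ; δ = λ f h → encodeAction (tmδ (decT f) h) }

δ-encT : ∀ s h → δ machine (encT s) h ≡ encodeAction (tmδ s h)
δ-encT s h = cong (λ z → encodeAction (tmδ z h)) (decT-encT s)

config : TMState → List Cell → Cell → List Cell → Config machine
config s l h r = cfg (encT s) l h r

step≡moveR : ∀ (N : TM) (c : Config N) q w → δ N (state c) (head c) ≡ just (q , w , R) → step N c ≡ moveR {N} q (left c) w (right c)
step≡moveR N c q w eq rewrite eq = refl

step≡moveL : ∀ (N : TM) (c : Config N) q w → δ N (state c) (head c) ≡ just (q , w , L) → step N c ≡ moveL {N} q (left c) w (right c)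
step≡moveL N c q w eq rewrite eq = refl

step-R : ∀ s l h r s' w → tmδ s h ≡ just (s' , w , R) → step machine (config s l h r) ≡ moveR {machine} (encT s') l w r
step-R s l h r s' w e = step≡moveR machine (config s l h r) (encT s') w (trans (δ-encT s h) (cong encodeAction e))

step-L : ∀ s l h r s' w → tmδ s h ≡ just (s' , w , L) → step machine (config s l h r) ≡ moveL {machine} (encT s') l w r
step-L s l h r s' w e = step≡moveL machine (config s l h r) (encT s') w (trans (δ-encT s h) (cong encodeAction e))

uncons : List Cell → Cell × List Cell
uncons [] = nothing , []
uncons (x ∷ xs) = x , xs

moveR-uncons : ∀ q l h r → moveR {machine} q l h r ≡ cfg q (h ∷ l) (proj₁ (uncons r)) (proj₂ (uncons r))
moveR-uncons q l h [] = refl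
moveR-uncons q l h (x ∷ r) = refl

steps-+ : ∀ {M} a b (c : Config M) → steps M (a + b) c ≡ steps M b (steps M a c)
steps-+ zero b c = refl
steps-+ {M} (suc a) b c = steps-+ a b (step M c)

Blank : List Cell → Set
Blank = All (_≡ nothing)

Holds : Cell → List Cell → List Γ → Set
Holds h r w = Σ (List Cell) λ pad → Blank pad × (h ∷ r ≡ map just w ++ pad)

Holds-uncons : ∀ {h r x w} → Holds h r (x ∷ w) → (h ≡ just x) × Holds (proj₁ (uncons r)) (proj₂ (uncons r)) w
Holds-uncons {w = w} (pad , bp , refl) = refl , lem w pad bp
  where
  lem : ∀ w pad → Blank pad → Holds (proj₁ (uncons (map just w ++ pad))) (proj₂ (uncons (map just w ++ pad))) w
  lem (y ∷ w) pad bp = pad , bp , refl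
  lem [] [] bp = nothing ∷ [] , refl ∷ [] , refl
  lem [] (p ∷ pad) (bp ∷ bps) = p ∷ pad , bp ∷ bps , refl

Holds-[] : ∀ {h r} → Holds h r [] → (h ≡ nothing) × Blank r
Holds-[] (.(_ ∷ _) , (bh ∷ br) , refl) = bh , br

blank-uncons : ∀ r → Blank r → (proj₁ (uncons r) ≡ nothing) × Blank (proj₂ (uncons r))
blank-uncons [] _ = refl , []
blank-uncons (x ∷ r) (bx ∷ br) = bx , br

pushReversed : List Γ → List Cell → List Cell
pushReversed [] l = l
pushReversed (y ∷ ys) l = pushReversed ys (just y ∷ l)

pushReversed-++ : ∀ xs ys l → pushReversed (xs ++ ys) l ≡ pushReversed ys (pushReversed xs l)
pushReversed-++ [] ys l = refl
pushReversed-++ (x ∷ xs) ys l = pushReversed-++ xs ys (just x ∷ l)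

map-just-reverse-∷ : ∀ (Rs : List Γ) y (cs : List Cell) → map just (reverse Rs) ++ just y ∷ cs ≡ map just (reverse (y ∷ Rs)) ++ cs
map-just-reverse-∷ Rs y cs = begin
    map just (reverse Rs) ++ just y ∷ cs ≡⟨ sym (LP.++-assoc (map just (reverse Rs)) (just y ∷ []) cs) ⟩
    (map just (reverse Rs) ++ just y ∷ []) ++ cs ≡⟨ cong (_++ cs) (sym (LP.map-++ just (reverse Rs) (y ∷ []))) ⟩
    map just (reverse Rs ++ y ∷ []) ++ cs ≡⟨ cong (λ z → map just z ++ cs) (sym (LP.unfold-reverse y Rs)) ⟩
    map just (reverse (y ∷ Rs)) ++ cs ∎
  where open ≡-Reasoning

pushReversed≡reverse : ∀ xs l → pushReversed xs l ≡ map just (reverse xs) ++ l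
pushReversed≡reverse [] l = refl
pushReversed≡reverse (x ∷ xs) l = trans (pushReversed≡reverse xs (just x ∷ l)) (map-just-reverse-∷ xs x l)

allVec : ∀ {A : Set} {n} → (A → Bool) → Vec A n → Bool
allVec p [] = true
allVec p (x ∷ xs) = p x ∧ allVec p xs

allVec-sound : ∀ {A : Set} {n} (p : A → Bool) (v : Vec A n) → allVec p v ≡ true → ∀ i → p (V.lookup v i) ≡ true
allVec-sound p (x ∷ v) e fz with p x
... | true = refl
allVec-sound p (x ∷ v) e (fs i) with p x
... | true = allVec-sound p v e i

emitted-length-check : State → Bool
emitted-length-check q = allVec (λ x → length (emitted q x) ≤ᵇ 13) (allFin 16)

emitted-length-check-all : allVec emitted-length-check allQ ≡ true
emitted-length-check-all = refl

≡true⇒T : ∀ {b} → b ≡ true → T b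
≡true⇒T refl = tt

emitted-length : ∀ q x → length (emitted q x) ≤ 13
emitted-length q x = ≤ᵇ⇒≤ _ 13 (≡true⇒T (subst (λ z → (length (emitted q z) ≤ᵇ 13) ≡ true) (VP.lookup-allFin x)
   (allVec-sound (λ x → length (emitted q x) ≤ᵇ 13) (allFin 16)
     (subst (λ z → emitted-length-check z ≡ true) (decQ-encQ q) (allVec-sound emitted-length-check allQ emitted-length-check-all (encQ q))) x)))

phase-read : ∀ q x q1 u l r → transition q x ≡ just (q1 , u) →
  step machine (config (Read q) l (just x) r) ≡ config (Carry q x fz) (nothing ∷ l) (proj₁ (uncons r)) (proj₂ (uncons r))
phase-read q x q1 u l r e = trans (step-R (Read q) l (just x) r (Carry q x fz) nothing (cong (δ-Read q x) e)) (moveR-uncons _ l nothing r)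

phase-scan : ∀ q x i w l h r → Holds h r w → Σ Cell λ h' → Σ (List Cell) λ r' →
   (steps machine (length w) (config (Carry q x i) l h r) ≡ config (Carry q x i) (pushReversed w l) h' r') × (h' ≡ nothing) × Blank r'
phase-scan q x i [] l h r holds = h , r , refl , Holds-[] holds
phase-scan q x i (y ∷ w) l h r holds =
  let (h≡y , holds′) = Holds-uncons {h} {r} holds
      (h′ , r′ , scan≡ , h′≡ , blank) = phase-scan q x i w (just y ∷ l) (proj₁ (uncons r)) (proj₂ (uncons r)) holds′
      step≡ = trans (step-R (Carry q x i) l h r (Carry q x i) (just y) (cong (tmδ (Carry q x i)) h≡y)) (moveR-uncons _ l (just y) r)
  in h′ , r′ , trans (cong (steps machine (length w)) step≡) scan≡ , h′≡ , blank

drop-suc : ∀ {A : Set} k (u : List A) {y v} → drop k u ≡ y ∷ v → drop (suc k) u ≡ v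
drop-suc zero (z ∷ u) refl = refl
drop-suc (suc k) [] ()
drop-suc (suc k) (z ∷ u) e = drop-suc k u e

phase-write : ∀ q x v i l r → drop (toℕ i) (emitted q x) ≡ v → toℕ i + length v ≤ 13 → Blank r →
  Σ (Fin 14) λ i' → Σ (List Cell) λ r' →
  (steps machine (length v) (config (Carry q x i) l nothing r) ≡ config (Carry q x i') (pushReversed v l) nothing r') × (drop (toℕ i') (emitted q x) ≡ []) × Blank r'
phase-write q x [] i l r d b br = i , r , refl , d , br
phase-write q x (y ∷ v) i l r d b br =
  let (i′ , r′ , write≡ , done , blank) = phase-write q x v (incF i) (just y ∷ l) (proj₂ (uncons r)) d′ b′ (proj₂ r-blank)
  in i′ , r′ , trans (cong (steps machine (length v)) step≡) write≡ , done , blank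
  where
  r-blank = blank-uncons r br
  i<13 : toℕ i < 13
  i<13 = ≤-trans (s≤s (m≤m+n (toℕ i) (length v))) (≤-trans (≤-reflexive (sym (+-suc (toℕ i) (length v)))) b)
  d′ : drop (toℕ (incF i)) (emitted q x) ≡ v
  d′ = trans (cong (λ z → drop z (emitted q x)) (toℕ-incF i i<13)) (drop-suc (toℕ i) (emitted q x) d)
  b′ : toℕ (incF i) + length v ≤ 13
  b′ = ≤-trans (≤-reflexive (trans (cong (_+ length v) (toℕ-incF i i<13)) (sym (+-suc (toℕ i) (length v))))) b
  step≡ : step machine (config (Carry q x i) l nothing r) ≡ config (Carry q x (incF i)) (just y ∷ l) nothing (proj₂ (uncons r))
  step≡ = trans (step-R (Carry q x i) l nothing r (Carry q x (incF i)) (just y) (cong (δ-CarryEnd q x i) d))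
        (trans (moveR-uncons _ l (just y) r) (cong (λ z → config (Carry q x (incF i)) (just y ∷ l) z (proj₂ (uncons r))) (proj₁ r-blank)))

phase-scanLeft : ∀ q1 l0 Rs z rr → steps machine (suc (length Rs)) (config (Return q1) (map just Rs ++ nothing ∷ l0) (just z) rr)
                            ≡ config (Return q1) l0 nothing (map just (reverse Rs) ++ just z ∷ rr)
phase-scanLeft q1 l0 [] z rr = step-L (Return q1) (nothing ∷ l0) (just z) rr (Return q1) (just z) refl
phase-scanLeft q1 l0 (y ∷ Rs) z rr =
  trans (cong (steps machine (suc (length Rs))) (step-L (Return q1) (just y ∷ map just Rs ++ nothing ∷ l0) (just z) rr (Return q1) (just z) refl))
        (trans (phase-scanLeft q1 l0 Rs y (just z ∷ rr)) (cong (config (Return q1) l0 nothing) (map-just-reverse-∷ Rs y (just z ∷ rr))))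

phase-end : ∀ q x i l0 Rs r → drop (toℕ i) (emitted q x) ≡ [] →
  steps machine (suc (length Rs)) (config (Carry q x i) (map just Rs ++ nothing ∷ l0) nothing r) ≡ config (Return (nextState q x)) l0 nothing (map just (reverse Rs) ++ nothing ∷ r)
phase-end q x i l0 [] r d = step-L (Carry q x i) (nothing ∷ l0) nothing r (Return (nextState q x)) nothing (cong (δ-CarryEnd q x i) d)
phase-end q x i l0 (y ∷ Rs) r d =
  trans (cong (steps machine (suc (length Rs))) (step-L (Carry q x i) (just y ∷ map just Rs ++ nothing ∷ l0) nothing r (Return (nextState q x)) nothing (cong (δ-CarryEnd q x i) d)))
        (trans (phase-scanLeft (nextState q x) l0 Rs y (nothing ∷ r)) (cong (config (Return (nextState q x)) l0 nothing) (map-just-reverse-∷ Rs y (nothing ∷ r))))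

phase-return : ∀ q1 l0 rr → step machine (config (Return q1) l0 nothing rr) ≡ config (Read q1) (nothing ∷ l0) (proj₁ (uncons rr)) (proj₂ (uncons rr))
phase-return q1 l0 rr = trans (step-R (Return q1) l0 nothing rr (Read q1) nothing refl) (moveR-uncons _ l0 nothing rr)

Holds-after-return : ∀ V r → Blank r → Holds (proj₁ (uncons (map just V ++ nothing ∷ r))) (proj₂ (uncons (map just V ++ nothing ∷ r))) V
Holds-after-return [] r br = nothing ∷ r , refl ∷ br , refl
Holds-after-return (y ∷ V) r br = nothing ∷ r , refl ∷ br , refl

emitted-≡ : ∀ q x {q1 u} → transition q x ≡ just (q1 , u) → emitted q x ≡ u
emitted-≡ q x e = cong emittedBy e

nextState-≡ : ∀ q x {q1 u} → transition q x ≡ just (q1 , u) → nextState q x ≡ q1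
nextState-≡ q x e = cong (nextStateBy q) e

sweep-right : ∀ q x w q1 u l h r → transition q x ≡ just (q1 , u) → Holds h r (x ∷ w) →
  Σ (Fin 14) λ i → Σ (List Cell) λ r′ →
  (steps machine (1 + (length w + length u)) (config (Read q) l h r)
     ≡ config (Carry q x i) (pushReversed u (pushReversed w (nothing ∷ l))) nothing r′)
  × (drop (toℕ i) (emitted q x) ≡ []) × Blank r′
sweep-right q x w q1 u l h r e holds =
  let (h≡x , holds′) = Holds-uncons {h} {r} holds
      (h₂ , r₂ , scan≡ , h₂≡ , blank₂) = phase-scan q x fz w (nothing ∷ l) (proj₁ (uncons r)) (proj₂ (uncons r)) holds′
      (i , r₃ , write≡ , done , blank₃) = phase-write q x u fz (pushReversed w (nothing ∷ l)) r₂ (emitted-≡ q x e)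
                                            (subst (λ z → length z ≤ 13) (emitted-≡ q x e) (emitted-length q x)) blank₂
      c₁ = config (Carry q x fz) (nothing ∷ l) (proj₁ (uncons r)) (proj₂ (uncons r))
  in i , r₃ ,
     trans (cong (steps machine (length w + length u)) (trans (cong (λ z → step machine (config (Read q) l z r)) h≡x) (phase-read q x q1 u l r e)))
     (trans (steps-+ (length w) (length u) c₁)
     (trans (cong (steps machine (length u)) (trans scan≡ (cong (λ z → config (Carry q x fz) (pushReversed w (nothing ∷ l)) z r₂) h₂≡)))
            write≡)) ,
     done , blank₃

sweep-left : ∀ q x i l V r → drop (toℕ i) (emitted q x) ≡ [] →
  steps machine (suc (length V) + 1) (config (Carry q x i) (map just (reverse V) ++ nothing ∷ l) nothing r)
  ≡ config (Read (nextState q x)) (nothing ∷ l) (proj₁ (uncons (map just V ++ nothing ∷ r))) (proj₂ (uncons (map just V ++ nothing ∷ r)))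
sweep-left q x i l V r done = begin
    steps machine (suc (length V) + 1) c ≡⟨ steps-+ (suc (length V)) 1 c ⟩
    steps machine 1 (steps machine (suc (length V)) c)
      ≡⟨ cong (λ k → steps machine 1 (steps machine (suc k) c)) (sym (LP.length-reverse V)) ⟩
    steps machine 1 (steps machine (suc (length (reverse V))) c)
      ≡⟨ cong (steps machine 1) (phase-end q x i l (reverse V) r done) ⟩
    steps machine 1 (config (Return (nextState q x)) l nothing (map just (reverse (reverse V)) ++ nothing ∷ r))
      ≡⟨ cong (λ b → steps machine 1 (config (Return (nextState q x)) l nothing (map just b ++ nothing ∷ r))) (LP.reverse-involutive V) ⟩
    steps machine 1 (config (Return (nextState q x)) l nothing (map just V ++ nothing ∷ r)) ≡⟨ phase-return (nextState q x) l _ ⟩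
    config (Read (nextState q x)) (nothing ∷ l) (proj₁ (uncons (map just V ++ nothing ∷ r))) (proj₂ (uncons (map just V ++ nothing ∷ r))) ∎
  where
  open ≡-Reasoning
  c = config (Carry q x i) (map just (reverse V) ++ nothing ∷ l) nothing r

simulate-transition : ∀ q x w q1 u l h r → transition q x ≡ just (q1 , u) → Holds h r (x ∷ w) →
  Σ Cell λ h' → Σ (List Cell) λ r' →
  (steps machine (2 * length w + 2 * length u + 3) (config (Read q) l h r) ≡ config (Read q1) (nothing ∷ l) h' r') × Holds h' r' (w ++ u)
simulate-transition q x w q1 u l h r e holds =
  let (i , r′ , right≡ , done , blank) = sweep-right q x w q1 u l h r e holds
      c = config (Read q) l h r
      V = w ++ u
  in proj₁ (uncons (map just V ++ nothing ∷ r′)) , proj₂ (uncons (map just V ++ nothing ∷ r′)) ,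
     trans (cong (λ t → steps machine t c) (sym (transition-time (length w) (length u) (length V) (LP.length-++ w))))
     (trans (steps-+ (1 + (length w + length u)) (suc (length V) + 1) c)
     (trans (cong (steps machine (suc (length V) + 1))
                  (trans right≡ (cong (λ z → config (Carry q x i) z nothing r′)
                                      (trans (sym (pushReversed-++ w u (nothing ∷ l))) (pushReversed≡reverse V (nothing ∷ l))))))
     (trans (sweep-left q x i l V r′ done)
            (cong (λ q′ → config (Read q′) (nothing ∷ l) (proj₁ (uncons (map just V ++ nothing ∷ r′))) (proj₂ (uncons (map just V ++ nothing ∷ r′))))
                  (nextState-≡ q x e))))) ,
     Holds-after-return V r′ blank
  where
  transition-time : ∀ a b v → v ≡ a + b → 1 + (a + b) + (suc v + 1) ≡ 2 * a + 2 * b + 3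
  transition-time a b .(a + b) refl = solve-∀′ a b
    where
    solve-∀′ : ∀ a b → 1 + (a + b) + (suc (a + b) + 1) ≡ 2 * a + 2 * b + 3
    solve-∀′ = solve-∀

pass-time₁ : ∀ a b c d → (2 * (a + b) + 2 * c + 3) + (2 + 2 * d) ≡ 2 * (suc a + b + (c + d)) + 3
pass-time₁ = solve-∀

pass-time₂ : ∀ a b c d → (2 * (a + (b + c) + d) + 3) + 2 ≡ 2 * (suc a + b + (c + d)) + 3
pass-time₂ = solve-∀

pass-time-step : ∀ a b c d t2 → t2 ≤ a * (2 * (a + (b + c) + d) + 3) →
         2 * (a + b) + 2 * c + 3 + t2 ≤ suc a * (2 * (suc a + b + (c + d)) + 3)
pass-time-step a b c d t2 h = +-mono-≤ h1 (≤-trans h (*-monoʳ-≤ a h2))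
  where
  h1 : 2 * (a + b) + 2 * c + 3 ≤ 2 * (suc a + b + (c + d)) + 3
  h1 = ≤-trans (m≤m+n _ (2 + 2 * d)) (≤-reflexive (pass-time₁ a b c d))
  h2 : 2 * (a + (b + c) + d) + 3 ≤ 2 * (suc a + b + (c + d)) + 3
  h2 = ≤-trans (m≤m+n _ 2) (≤-reflexive (pass-time₂ a b c d))

Reaches : State → List Cell → Cell → List Cell → ℕ → State → List Γ → Set
Reaches q l h r t q' w' = Σ (List Cell) λ l' → Σ Cell λ h' → Σ (List Cell) λ r' →
  (steps machine t (config (Read q) l h r) ≡ config (Read q') l' h' r') × Blank l' × Holds h' r' w'

simulate-pass : ∀ {q xs q' o} → Pass q xs q' o → ∀ ys l h r → Blank l → Holds h r (xs ++ ys) →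
  Σ ℕ λ t → (t ≤ length xs * (2 * (length xs + length ys + length o) + 3)) × Reaches q l h r t q' (ys ++ o)
simulate-pass tnil ys l h r blank holds = 0 , z≤n , l , h , r , refl , blank , subst (Holds h r) (sym (LP.++-identityʳ ys)) holds
simulate-pass {q} {x ∷ xs} {q'} (tcons {q1 = q1} {u = u} {o = o} e pass) ys l h r blank holds =
  let (h₁ , r₁ , steps₁ , holds₁) = simulate-transition q x (xs ++ ys) q1 u l h r e holds
      (t₂ , t₂≤ , l₂ , h₂ , r₂ , steps₂ , blank₂ , holds₂) =
        simulate-pass pass (ys ++ u) (nothing ∷ l) h₁ r₁ (refl ∷ blank) (subst (Holds h₁ r₁) (LP.++-assoc xs ys u) holds₁)
      t₁ = 2 * length (xs ++ ys) + 2 * length u + 3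
  in t₁ + t₂ ,
     subst (λ z → t₁ + t₂ ≤ suc (length xs) * (2 * (suc (length xs) + length ys + z) + 3)) (sym (LP.length-++ u))
       (subst (λ z → 2 * z + 2 * length u + 3 + t₂ ≤ suc (length xs) * (2 * (suc (length xs) + length ys + (length u + length o)) + 3))
              (sym (LP.length-++ xs))
         (pass-time-step (length xs) (length ys) (length u) (length o) t₂
           (subst (λ z → t₂ ≤ length xs * (2 * (length xs + z + length o) + 3)) (LP.length-++ ys) t₂≤))) ,
     l₂ , h₂ , r₂ , trans (steps-+ t₁ t₂ (config (Read q) l h r)) (trans (cong (steps machine t₂) steps₁) steps₂) ,
     blank₂ , subst (Holds h₂ r₂) (LP.++-assoc ys u o) holds₂

data Run (B : ℕ) : State → List Γ → State → List Γ → ℕ → Set where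
  rdone : ∀ {q w} → Run B q w q w 0
  rpass : ∀ {q xs ys q1 o q2 w2 n} → Pass q xs q1 o → length xs + length ys + length o ≤ B →
          Run B q1 (ys ++ o) q2 w2 n → Run B q (xs ++ ys) q2 w2 (suc n)

simulate-run : ∀ {B q w q' w' n} → Run B q w q' w' n → ∀ l h r → Blank l → Holds h r w →
  Σ ℕ λ t → (t ≤ n * (B * (2 * B + 3))) × Reaches q l h r t q' w'
simulate-run rdone l h r blank holds = 0 , z≤n , l , h , r , refl , blank , holds
simulate-run {B} {q} (rpass {xs = xs} {ys = ys} {o = o} {n = n} pass size run) l h r blank holds =
  let (t₁ , t₁≤ , l₁ , h₁ , r₁ , steps₁ , blank₁ , holds₁) = simulate-pass pass ys l h r blank holds
      (t₂ , t₂≤ , l₂ , h₂ , r₂ , steps₂ , blank₂ , holds₂) = simulate-run run l₁ h₁ r₁ blank₁ holds₁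
      xs≤B = ≤-trans (≤-trans (m≤m+n (length xs) (length ys)) (m≤m+n _ (length o))) size
  in t₁ + t₂ , +-mono-≤ (≤-trans t₁≤ (*-mono-≤ xs≤B (+-monoˡ-≤ 3 (*-monoʳ-≤ 2 size)))) t₂≤ ,
     l₂ , h₂ , r₂ , trans (steps-+ t₁ t₂ (config (Read q) l h r)) (trans (cong (steps machine t₂) steps₁) steps₂) ,
     blank₂ , holds₂

halted : ∀ l h r → Halted machine (config (Read Halt) l h r)
halted l nothing r = δ-encT (Read Halt) nothing
halted l (just x) r = δ-encT (Read Halt) (just x)

output-rep : ∀ l h r w → Holds h r w → output {machine} (config (Read Halt) l h r) ≡ map just w
output-rep l h r w (pad , bp , e) = trans (cong (takeWhile _) e) (takeWhile-just w pad bp)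
  where
  takeWhile-just : ∀ w pad → Blank pad → takeWhile (λ x → Data.Bool.T? (Data.Maybe.is-just x)) (map just w ++ pad) ≡ map just w
  takeWhile-just (x ∷ w) pad bp = cong (just x ∷_) (takeWhile-just w pad bp)
  takeWhile-just [] [] bp = refl
  takeWhile-just [] (.nothing ∷ pad) (refl ∷ bp) = refl

-- Lengths of the queues

weight : List ListTerm → ℕ
weight [] = 0
weight ((c , es) ∷ ts) = suc (length es) + weight ts

weight-++ : ∀ xs ys → weight (xs ++ ys) ≡ weight xs + weight ys
weight-++ [] ys = refl
weight-++ ((c , es) ∷ xs) ys = trans (cong (suc (length es) +_) (weight-++ xs ys)) (sym (+-assoc (suc (length es)) (weight xs) (weight ys)))

μ : Block → ℕ
μ (block r d a) = length r + weight (d ++ fromMaybe a) + 2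

μs : List Block → ℕ
μs [] = 0
μs (b ∷ bss) = μ b + μs bss

μ-step : ∀ c b → μ (consumeDigit c b) ≤ μ b
μ-step c (block [] d a) = ≤-refl
μ-step true (block (e ∷ r) d a) = ≤-reflexive (cong (λ z → z + 2) eq)
  where
  eq : length r + weight ((d ++ fromMaybe a) ++ (e , []) ∷ []) ≡ suc (length r + weight (d ++ fromMaybe a))
  eq = trans (cong (length r +_) (trans (weight-++ (d ++ fromMaybe a) ((e , []) ∷ [])) (+-comm (weight (d ++ fromMaybe a)) 1)))
             (+-suc (length r) (weight (d ++ fromMaybe a)))
μ-step false (block (e ∷ r) d nothing) = +-monoˡ-≤ 2 (≤-trans (n≤1+n _) (≤-reflexive refl))
μ-step false (block (e ∷ r) d (just (c , es))) = ≤-reflexive (cong (λ z → z + 2) eq)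
  where
  eq : length r + weight (d ++ (c , es ++ e ∷ []) ∷ []) ≡ suc (length r + weight (d ++ (c , es) ∷ []))
  eq = begin
      length r + weight (d ++ (c , es ++ e ∷ []) ∷ []) ≡⟨ cong (length r +_) (weight-++ d _) ⟩
      length r + (weight d + (suc (length (es ++ e ∷ [])) + 0)) ≡⟨ cong (λ z → length r + (weight d + (suc z + 0))) (trans (LP.length-++ es) (+-comm (length es) 1)) ⟩
      length r + (weight d + (suc (suc (length es)) + 0)) ≡⟨ ar (length r) (weight d) (length es) ⟩
      suc (length r + (weight d + (suc (length es) + 0))) ≡⟨ cong (λ z → suc (length r + z)) (sym (weight-++ d _)) ⟩
      suc (length r + weight (d ++ (c , es) ∷ [])) ∎
    where
    open ≡-Reasoning
    ar : ∀ a b x → a + (b + (suc (suc x) + 0)) ≡ suc (a + (b + (suc x + 0)))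
    ar = solve-∀

μs-step : ∀ c bss → μs (map (consumeDigit c) bss) ≤ μs bss
μs-step c [] = ≤-refl
μs-step c (b ∷ bss) = +-mono-≤ (μ-step c b) (μs-step c bss)

len-varSyms : ∀ m → length (varSyms m) ≡ m + 2
len-varSyms m = trans (cong suc (trans (LP.length-++ (replicate m A1)) (cong (_+ 1) (LP.length-replicate m)))) (sym (+-suc m 1))

len-cubeSyms : ∀ W e m → m ≤ W → length (cubeSyms e m) ≤ 3 * W + 6
len-cubeSyms W fz m h = z≤n
len-cubeSyms W (fs (fs fz)) m h = z≤n
len-cubeSyms W (fs fz) m h = ≤-trans (≤-reflexive eq) (≤-trans (*-monoʳ-≤ 3 (+-monoˡ-≤ 2 h)) (≤-reflexive (ar W)))
  where
  eq : length (varSyms m ++ varSyms m ++ varSyms m) ≡ 3 * (m + 2)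
  eq = trans (LP.length-++ (varSyms m)) (trans (cong (length (varSyms m) +_) (LP.length-++ (varSyms m)))
         (trans (cong₂ (λ a b → a + (b + b)) (len-varSyms m) (len-varSyms m)) (ar2 m)))
    where
    ar2 : ∀ m → m + 2 + (m + 2 + (m + 2)) ≡ 3 * (m + 2)
    ar2 = solve-∀
  ar : ∀ W → 3 * (W + 2) ≡ 3 * W + 6
  ar = solve-∀

≤-pred-+ : ∀ k x W → k + suc x ≤ W → k + x ≤ W
≤-pred-+ k x W h = ≤-trans (+-monoʳ-≤ k (n≤1+n x)) h

len-leftCubes : ∀ W k es → k + length es ≤ W → length (leftCubes k es) ≤ length es * (3 * W + 6)
len-leftCubes W k [] h = z≤n
len-leftCubes W k (e ∷ es) h = ≤-trans (≤-reflexive (LP.length-++ (cubeSyms e (k + length es))))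
  (+-mono-≤ (len-cubeSyms W e (k + length es) (≤-pred-+ k (length es) W h))
            (len-leftCubes W k es (≤-pred-+ k (length es) W h)))

len-rightCubes : ∀ W k es → k + length es ≤ W → length (rightCubes k es) ≤ length es * (3 * W + 6)
len-rightCubes W k [] h = z≤n
len-rightCubes W k (e ∷ es) h = ≤-trans (≤-reflexive (trans (LP.length-++ (rightCubes k es)) (+-comm (length (rightCubes k es)) _)))
  (+-mono-≤ (len-cubeSyms W e (k + length es) (≤-pred-+ k (length es) W h))
            (len-rightCubes W k es (≤-pred-+ k (length es) W h)))

len-termSyms : ∀ W c es → length es ≤ W → length (termSyms (c , es)) ≤ suc (length es) * (6 * W + 12)
len-termSyms W c es h = ≤-trans (≤-reflexive (LP.length-++ (leftCubes 0 es)))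
  (≤-trans (+-mono-≤ (len-leftCubes W 0 es h) (s≤s (len-rightCubes W 0 es h)))
  (≤-trans (m≤m+n _ (6 * W + 11)) (≤-reflexive (ar (length es) W))))
  where
  ar : ∀ x W → x * (3 * W + 6) + suc (x * (3 * W + 6)) + (6 * W + 11) ≡ suc x * (6 * W + 12)
  ar = solve-∀

one≤C : ∀ W → 1 ≤ 6 * W + 12
one≤C W = ≤-trans (s≤s z≤n) (m≤n+m 12 (6 * W))

m≤m*n′ : ∀ a C → 1 ≤ C → a ≤ a * C
m≤m*n′ a C h = ≤-trans (≤-reflexive (sym (*-identityʳ a))) (*-monoʳ-≤ a h)

len-termSymss : ∀ W ts → weight ts ≤ W → length (concatMap termSyms ts) ≤ weight ts * (6 * W + 12)
len-termSymss W [] h = z≤n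
len-termSymss W ((c , es) ∷ ts) h = ≤-trans (≤-reflexive (LP.length-++ (termSyms (c , es))))
  (≤-trans (+-mono-≤ (len-termSyms W c es (≤-trans (n≤1+n _) (≤-trans (m≤m+n (suc (length es)) (weight ts)) h)))
                     (len-termSymss W ts (≤-trans (m≤n+m (weight ts) (suc (length es))) h)))
           (≤-reflexive (sym (*-distribʳ-+ (6 * W + 12) (suc (length es)) (weight ts)))))

len-contentSyms : ∀ W d a → weight (d ++ fromMaybe a) ≤ W → length (concatMap termSyms d ++ activeSyms a) ≤ weight (d ++ fromMaybe a) * (6 * W + 12) + 1
len-contentSyms W d nothing h = ≤-trans (≤-reflexive (trans (cong length (LP.++-identityʳ (concatMap termSyms d))) (cong (λ z → length (concatMap termSyms z)) (sym (LP.++-identityʳ d)))))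
  (≤-trans (len-termSymss W (d ++ []) h) (m≤m+n _ 1))
len-contentSyms W d (just t) h = ≤-trans (≤-reflexive eq) (≤-trans (+-monoˡ-≤ 1 (len-termSymss W (d ++ t ∷ []) h)) ≤-refl)
  where
  eq : length (concatMap termSyms d ++ CS ∷ termSyms t) ≡ length (concatMap termSyms (d ++ t ∷ [])) + 1
  eq = begin
      length (concatMap termSyms d ++ CS ∷ termSyms t) ≡⟨ LP.length-++ (concatMap termSyms d) ⟩
      length (concatMap termSyms d) + suc (length (termSyms t)) ≡⟨ +-suc _ _ ⟩
      suc (length (concatMap termSyms d) + length (termSyms t)) ≡⟨ +-comm 1 _ ⟩
      length (concatMap termSyms d) + length (termSyms t) + 1
        ≡⟨ cong (_+ 1) (sym (trans (cong length (LP.concatMap-++ termSyms d (t ∷ []))) (trans (LP.length-++ (concatMap termSyms d)) (cong (length (concatMap termSyms d) +_) (cong length (LP.++-identityʳ (termSyms t))))))) ⟩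
      length (concatMap termSyms (d ++ t ∷ [])) + 1 ∎
    where open ≡-Reasoning

len-blockSyms : ∀ W b → μ b ≤ W → length (blockSyms b) ≤ μ b * (6 * W + 12)
len-blockSyms W (block r d a) h = ≤-trans (≤-reflexive eq1)
  (≤-trans (+-mono-≤ (m≤m*n′ (length r) C (one≤C W)) (+-monoˡ-≤ 1 (len-contentSyms W d a hw)))
  (≤-trans (≤-reflexive (ar (length r) (weight (d ++ fromMaybe a)) C)) (≤-trans (+-monoʳ-≤ (length r * C + weight (d ++ fromMaybe a) * C) (*-monoʳ-≤ 2 (one≤C W))) (≤-reflexive (ar2 (length r) (weight (d ++ fromMaybe a)) C)))))
  where
  C = 6 * W + 12
  hw : weight (d ++ fromMaybe a) ≤ W
  hw = ≤-trans (m≤n+m _ (length r)) (≤-trans (m≤m+n _ 2) h)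
  eq1 : length (blockSyms (block r d a)) ≡ length r + (length (concatMap termSyms d ++ activeSyms a) + 1)
  eq1 = begin
      length (map digitSym r ++ concatMap termSyms d ++ activeSyms a ++ TR ∷ []) ≡⟨ LP.length-++ (map digitSym r) ⟩
      length (map digitSym r) + length (concatMap termSyms d ++ activeSyms a ++ TR ∷ []) ≡⟨ cong₂ _+_ (LP.length-map digitSym r) (cong length (sym (LP.++-assoc (concatMap termSyms d) (activeSyms a) (TR ∷ [])))) ⟩
      length r + length ((concatMap termSyms d ++ activeSyms a) ++ TR ∷ []) ≡⟨ cong (length r +_) (LP.length-++ (concatMap termSyms d ++ activeSyms a)) ⟩
      length r + (length (concatMap termSyms d ++ activeSyms a) + 1) ∎
    where open ≡-Reasoning
  ar : ∀ x y C → x * C + (y * C + 1 + 1) ≡ x * C + y * C + 2 * 1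
  ar = solve-∀
  ar2 : ∀ x y C → x * C + y * C + 2 * C ≡ (x + y + 2) * C
  ar2 = solve-∀

len-blockSymss : ∀ W bss → μs bss ≤ W → length (concatMap blockSyms bss) ≤ μs bss * (6 * W + 12)
len-blockSymss W [] h = z≤n
len-blockSymss W (b ∷ bss) h = ≤-trans (≤-reflexive (LP.length-++ (blockSyms b)))
  (≤-trans (+-mono-≤ (len-blockSyms W b (≤-trans (m≤m+n (μ b) (μs bss)) h)) (len-blockSymss W bss (≤-trans (m≤n+m (μs bss) (μ b)) h)))
           (≤-reflexive (sym (*-distribʳ-+ (6 * W + 12) (μ b) (μs bss)))))

len-headerSyms : ∀ n h → Valid n h → length (headerSyms n h) ≡ n + 2
len-headerSyms n fresh v = trans (LP.length-++ (replicate (suc n) Ch)) (trans (cong (_+ 1) (LP.length-replicate (suc n))) (sym (+-suc n 1)))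
len-headerSyms .(m + k) (at m k) refl = trans (LP.length-++ (replicate m Ch))
  (trans (cong₂ (λ a b → a + suc b) (LP.length-replicate m) (trans (LP.length-++ (replicate k Ch)) (cong (_+ 1) (LP.length-replicate k))))
         (ar m k))
  where
  ar : ∀ m k → m + suc (k + 1) ≡ m + k + 2
  ar = solve-∀

roundBound : ℕ → ℕ → ℕ
roundBound n W = n + 3 + W * (6 * W + 12)

len-roundTape-≡ : ∀ n h bss → Valid n h → length (roundTape n h bss) ≡ n + 3 + length (concatMap blockSyms bss)
len-roundTape-≡ n h bss v = trans (LP.length-++ (headerSyms n h)) (trans (cong₂ _+_ (len-headerSyms n h v) (trans (LP.length-++ (concatMap blockSyms bss)) (+-comm _ 1)))
         (ar n (length (concatMap blockSyms bss))))
  where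
  ar : ∀ n x → n + 2 + (1 + x) ≡ n + 3 + x
  ar = solve-∀

len-roundTape : ∀ n W h bss → Valid n h → μs bss ≤ W → length (roundTape n h bss) ≤ roundBound n W
len-roundTape n W h bss v hm = ≤-trans (≤-reflexive (len-roundTape-≡ n h bss v)) (≤-trans (+-monoʳ-≤ (n + 3) (len-blockSymss W bss hm)) (+-monoʳ-≤ (n + 3) (*-monoˡ-≤ (6 * W + 12) hm)))

len-outputSyms : ∀ x → length (outputSyms x) ≤ 5
len-outputSyms D0 = z≤n
len-outputSyms D1 = z≤n
len-outputSyms D2 = z≤n
len-outputSyms SH = z≤n
len-outputSyms TR = z≤n
len-outputSyms Ch = z≤n
len-outputSyms CH = z≤n
len-outputSyms CZ = z≤n
len-outputSyms CR = z≤n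
len-outputSyms CS = z≤n
len-outputSyms A2 = s≤s z≤n
len-outputSyms A1 = s≤s z≤n
len-outputSyms A0 = s≤s z≤n
len-outputSyms M0 = ≤-refl
len-outputSyms M1 = ≤-refl
len-outputSyms M2 = ≤-refl

len-outputSymss : ∀ w → length (concatMap outputSyms w) ≤ 5 * length w
len-outputSymss [] = z≤n
len-outputSymss (x ∷ w) = ≤-trans (≤-reflexive (LP.length-++ (outputSyms x)))
  (≤-trans (+-mono-≤ (len-outputSyms x) (len-outputSymss w)) (≤-reflexive (sym (*-distribˡ-+ 5 1 (length w)))))

len-finalBlockSyms : ∀ w → length (finalBlockSyms w) ≤ 6 * (length w + 1)
len-finalBlockSyms [] = ≤-refl
len-finalBlockSyms (y ∷ ys) = ≤-trans (≤-reflexive (trans (LP.length-++ (concatMap outputSyms (y ∷ ys))) (+-comm _ 1)))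
  (≤-trans (s≤s (len-outputSymss (y ∷ ys))) (≤-trans (m≤m+n _ (length ys + 6)) (≤-reflexive (ar (length ys)))))
  where
  ar : ∀ x → suc (5 * suc x) + (x + 6) ≡ 6 * (suc x + 1)
  ar = solve-∀

len-blockOutput : ∀ b → Idle b → length (blockOutput b) ≤ 6 * length (blockSyms b)
len-blockOutput (block .[] d a) refl = ≤-trans (≤-reflexive (cong length (sym (finalBlockSyms-contentSyms d a))))
  (≤-trans (len-finalBlockSyms (concatMap termSyms d ++ activeSyms a))
   (≤-reflexive (cong (6 *_) (sym (trans (cong length (sym (LP.++-assoc (concatMap termSyms d) (activeSyms a) (TR ∷ [])))) (LP.length-++ (concatMap termSyms d ++ activeSyms a)))))))

len-blockOutputs : ∀ bss → All Idle bss → length (concatMap blockOutput bss) ≤ 6 * length (concatMap blockSyms bss)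
len-blockOutputs [] [] = z≤n
len-blockOutputs (b ∷ bss) (i ∷ is) = ≤-trans (≤-reflexive (LP.length-++ (blockOutput b)))
  (≤-trans (+-mono-≤ (len-blockOutput b i) (len-blockOutputs bss is))
           (≤-reflexive (trans (sym (*-distribˡ-+ 6 (length (blockSyms b)) _)) (cong (6 *_) (sym (LP.length-++ (blockSyms b)))))))

len-finalOutput : ∀ n h bss → Valid n h → All Idle bss →
  length (replicate n D1 ++ SH ∷ concatMap blockOutput bss) ≤ 6 * length (roundTape n h bss)
len-finalOutput n h bss v is = ≤-trans (≤-reflexive eq)
  (≤-trans (+-monoʳ-≤ (n + 1) (len-blockOutputs bss is)) (≤-trans (m≤m+n (n + 1 + 6 * X) (5 * n + 17)) (≤-reflexive (trans (ar n X) (cong (6 *_) (sym (len-roundTape-≡ n h bss v)))))))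
  where
  X = length (concatMap blockSyms bss)
  eq : length (replicate n D1 ++ SH ∷ concatMap blockOutput bss) ≡ n + 1 + length (concatMap blockOutput bss)
  eq = trans (LP.length-++ (replicate n D1)) (trans (cong (_+ suc (length (concatMap blockOutput bss))) (LP.length-replicate n)) (ar0 n _))
    where
    ar0 : ∀ n x → n + suc x ≡ n + 1 + x
    ar0 = solve-∀
  ar : ∀ n X → n + 1 + 6 * X + (5 * n + 17) ≡ 6 * (n + 3 + X)
  ar = solve-∀

-- The complete run of the automaton

consumeExponents : ℕ → Block → Block
consumeExponents zero b = b
consumeExponents (suc i) b = consumeExponents i (consumeDigit false b)

consumeExponents-active : ∀ es₂ r d c es₁ → consumeExponents (length es₂) (block (es₂ ++ r) d (just (c , es₁))) ≡ block r d (just (c , es₁ ++ es₂))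
consumeExponents-active [] r d c es₁ = cong (λ z → block r d (just (c , z))) (sym (LP.++-identityʳ es₁))
consumeExponents-active (e ∷ es) r d c es₁ = trans (consumeExponents-active es r d c (es₁ ++ e ∷ [])) (cong (λ z → block r d (just (c , z))) (LP.++-assoc es₁ (e ∷ []) es))

consumeExponents-hasDigits : ∀ es₂ r d c es₁ i → i < length es₂ → hasDigits (consumeExponents i (block (es₂ ++ r) d (just (c , es₁)))) ≡ true
consumeExponents-hasDigits (e ∷ es) r d c es₁ zero _ = refl
consumeExponents-hasDigits (e ∷ es) r d c es₁ (suc i) (s≤s p) = consumeExponents-hasDigits es r d c (es₁ ++ e ∷ []) i p

take-length-++ : ∀ {A : Set} (xs ys : List A) → take (length xs) (xs ++ ys) ≡ xs
take-length-++ [] ys = refl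
take-length-++ (x ∷ xs) ys = cong (x ∷_) (take-length-++ xs ys)

drop-length-++ : ∀ {A : Set} (xs ys : List A) → drop (length xs) (xs ++ ys) ≡ ys
drop-length-++ [] ys = refl
drop-length-++ (x ∷ xs) ys = drop-length-++ xs ys

consumeDigit-idle : ∀ c b → Idle b → consumeDigit c b ≡ b
consumeDigit-idle c (block .[] d a) refl = refl

consumeExponents-idle : ∀ i b → Idle b → consumeExponents i b ≡ b
consumeExponents-idle zero b p = refl
consumeExponents-idle (suc i) (block .[] d a) refl = consumeExponents-idle i (block [] d a) refl

map-consumeDigit-idle : ∀ c bss → All Idle bss → map (consumeDigit c) bss ≡ bss
map-consumeDigit-idle c [] [] = refl
map-consumeDigit-idle c (b ∷ bss) (p ∷ ps) = cong₂ _∷_ (consumeDigit-idle c b p) (map-consumeDigit-idle c bss ps)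

anyDigits-idle : ∀ bss → All Idle bss → anyDigits bss ≡ false
anyDigits-idle [] [] = refl
anyDigits-idle (block .[] d a ∷ bss) (refl ∷ ps) = anyDigits-idle bss ps

anyDigits-any : ∀ bss → Any (λ b → hasDigits b ≡ true) bss → anyDigits bss ≡ true
anyDigits-any (b ∷ bss) (here p) rewrite p = refl
anyDigits-any (b ∷ bss) (there p) with hasDigits b
... | true = refl
... | false = anyDigits-any bss p

Any-map : ∀ {P Q : Block → Set} (f : Block → Block) → (∀ {b} → P b → Q (f b)) → ∀ {bss} → Any P bss → Any Q (map f bss)
Any-map f g (here p) = here (g p)
Any-map f g (there p) = there (Any-map f g p)

μ-consumeExponents : ∀ i b → μ (consumeExponents i b) ≤ μ b
μ-consumeExponents zero b = ≤-refl
μ-consumeExponents (suc i) b = ≤-trans (μ-consumeExponents i (consumeDigit false b)) (μ-step false b)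

μs-map-≤ : ∀ (f : Block → Block) → (∀ b → μ (f b) ≤ μ b) → ∀ bss → μs (map f bss) ≤ μs bss
μs-map-≤ f h [] = ≤-refl
μs-map-≤ f h (b ∷ bss) = +-mono-≤ (h b) (μs-map-≤ f h bss)

nextHeader-at0 : ∀ n → nextHeader n (at 0 n) ≡ startHeader n
nextHeader-at0 zero = refl
nextHeader-at0 (suc n) = refl

StartHeader : ℕ → Header → Set
StartHeader n h = (h ≡ fresh) ⊎ (h ≡ at 0 n)

module _ (n W : ℕ) where

  passBound : ℕ
  passBound = 7 * roundBound n W

  run-pass : ∀ {q xs q1 o q2 w2 k} → Pass q xs q1 o → length xs + length o ≤ passBound → Run passBound q1 o q2 w2 k → Run passBound q xs q2 w2 (suc k)
  run-pass {q} {xs} {q1} {o} {q2} {w2} {k} tr sz rn =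
    subst (λ z → Run passBound q z q2 w2 (suc k)) (LP.++-identityʳ xs)
      (rpass {ys = []} tr (≤-trans (≤-reflexive (cong (_+ length o) (+-identityʳ (length xs)))) sz) rn)

  rounds≤passBound : ∀ h h' bss bss' → Valid n h → Valid n h' → μs bss ≤ W → μs bss' ≤ W →
        length (roundTape n h bss) + length (roundTape n h' bss') ≤ passBound
  rounds≤passBound h h' bss bss' v v' m m' = ≤-trans (+-mono-≤ (len-roundTape n W h bss v m) (len-roundTape n W h' bss' v' m'))
    (≤-trans (m≤m+n (roundBound n W + roundBound n W) (5 * roundBound n W)) (≤-reflexive (ar (roundBound n W))))
    where
    ar : ∀ q → q + q + 5 * q ≡ 7 * q
    ar = solve-∀

  Ready : Block → Set
  Ready b = Σ ℤ₃ λ c → Σ (List ℤ₃) λ es → Σ (List ℤ₃) λ r → (pending b ≡ c ∷ es ++ r) × (length es ≡ n)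

  ReadyOrIdle : Block → Set
  ReadyOrIdle b = Ready b ⊎ Idle b

  termCycle : Block → Block
  termCycle (block [] d a) = block [] d a
  termCycle (block (c ∷ r) d a) = block (drop n r) (d ++ fromMaybe a) (just (c , take n r))

  termCycle-ready : ∀ b → Ready b → consumeExponents n (consumeDigit true b) ≡ termCycle b
  termCycle-ready (block .(c ∷ es ++ r) d a) (c , es , r , refl , ln) rewrite sym ln =
    trans (consumeExponents-active es r (d ++ fromMaybe a) c []) (cong₂ (λ x y → block x (d ++ fromMaybe a) (just (c , y))) (sym (drop-length-++ es r)) (sym (take-length-++ es r)))

  termCycle-readyOrIdle : ∀ b → ReadyOrIdle b → consumeExponents n (consumeDigit true b) ≡ termCycle b
  termCycle-readyOrIdle b (inj₁ p) = termCycle-ready b p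
  termCycle-readyOrIdle (block .[] d a) (inj₂ refl) = consumeExponents-idle n (block [] d a) refl

  all-termCycle : ∀ bss → All ReadyOrIdle bss → map (consumeExponents n) (map (consumeDigit true) bss) ≡ map termCycle bss
  all-termCycle [] [] = refl
  all-termCycle (b ∷ bss) (p ∷ ps) = cong₂ _∷_ (termCycle-readyOrIdle b p) (all-termCycle bss ps)

  hasDigits-ready : ∀ b → Ready b → hasDigits b ≡ true
  hasDigits-ready (block .(c ∷ es ++ r) d a) (c , es , r , refl , ln) = refl

  hasDigits-ready-consumeExponents : ∀ b → Ready b → ∀ i → i < n → hasDigits (consumeExponents i (consumeDigit true b)) ≡ true
  hasDigits-ready-consumeExponents (block .(c ∷ es ++ r) d a) (c , es , r , refl , ln) i p =
    consumeExponents-hasDigits es r (d ++ fromMaybe a) c [] i (≤-trans p (≤-reflexive (sym ln)))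

  exponent-rounds : ∀ k m bss → suc m + k ≡ n → (∀ i → i ≤ k → anyDigits (map (consumeExponents i) bss) ≡ true) → μs bss ≤ W →
    Run passBound (Hd0 false) (roundTape n (at (suc m) k) bss) (Hd0 true) (roundTape n fresh (map (consumeExponents (suc k)) bss)) (suc k)
  exponent-rounds zero m bss v ok hm = run-pass tr (rounds≤passBound (at (suc m) 0) fresh bss (map (consumeDigit false) bss) v tt hm (≤-trans (μs-step false bss) hm)) rdone
    where
    a0 : anyDigits bss ≡ true
    a0 = trans (cong anyDigits (sym (LP.map-id bss))) (ok 0 z≤n)
    tr : Pass (Hd0 false) (roundTape n (at (suc m) 0) bss) (Hd0 true) (roundTape n fresh (map (consumeDigit false) bss))
    tr = subst (λ z → Pass (Hd0 false) (roundTape n (at (suc m) 0) bss) (afterBlocks z true) (roundTape n fresh (map (consumeDigit false) bss))) a0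
           (round-pass n (at (suc m) 0) bss v)
  exponent-rounds (suc k) m bss v ok hm =
    run-pass tr (rounds≤passBound (at (suc m) (suc k)) (at (suc (suc m)) k) bss (map (consumeDigit false) bss) v v' hm hm')
      (subst (λ z → Run passBound (Hd0 false) (roundTape n (at (suc (suc m)) k) (map (consumeDigit false) bss)) (Hd0 true) (roundTape n fresh z) (suc k))
        (sym (LP.map-∘ bss))
        (exponent-rounds k (suc m) (map (consumeDigit false) bss) v' ok' hm'))
    where
    v' : suc (suc m) + k ≡ n
    v' = trans (sym (+-suc (suc m) k)) v
    hm' = ≤-trans (μs-step false bss) hm
    a0 : anyDigits bss ≡ true
    a0 = trans (cong anyDigits (sym (LP.map-id bss))) (ok 0 z≤n)
    ok' : ∀ i → i ≤ k → anyDigits (map (consumeExponents i) (map (consumeDigit false) bss)) ≡ true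
    ok' i p = trans (cong anyDigits (sym (LP.map-∘ bss))) (ok (suc i) (s≤s p))
    tr : Pass (Hd0 false) (roundTape n (at (suc m) (suc k)) bss) (Hd0 false) (roundTape n (at (suc (suc m)) k) (map (consumeDigit false) bss))
    tr = subst (λ z → Pass (Hd0 false) (roundTape n (at (suc m) (suc k)) bss) (afterBlocks z false) (roundTape n (at (suc (suc m)) k) (map (consumeDigit false) bss))) a0
           (round-pass n (at (suc m) (suc k)) bss v)

  remaining-rounds : ∀ k → k ≡ n → ∀ bss → (∀ i → i < k → anyDigits (map (consumeExponents i) bss) ≡ true) → μs bss ≤ W →
    Run passBound (Hd0 (isFresh (startHeader k))) (roundTape n (startHeader k) bss) (Hd0 true) (roundTape n fresh (map (consumeExponents k) bss)) k
  remaining-rounds zero e bss ok hm = subst (λ z → Run passBound (Hd0 true) (roundTape n fresh bss) (Hd0 true) (roundTape n fresh z) 0) (sym (LP.map-id bss)) rdone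
  remaining-rounds (suc k) e bss ok hm = exponent-rounds k 0 bss e (λ i p → ok i (s≤s p)) hm

  valid-StartHeader : ∀ h → StartHeader n h → Valid n h
  valid-StartHeader .fresh (inj₁ refl) = tt
  valid-StartHeader .(at 0 n) (inj₂ refl) = refl

  first-round : ∀ h bss → StartHeader n h →
    Pass (Hd0 (isFresh h)) (roundTape n h bss) (afterBlocks (anyDigits bss) (isFresh (startHeader n))) (roundTape n (startHeader n) (map (consumeDigit true) bss))
  first-round .fresh bss (inj₁ refl) = round-pass n fresh bss tt
  first-round .(at 0 n) bss (inj₂ refl) = subst (λ z → Pass (Hd0 false) (roundTape n (at 0 n) bss) (afterBlocks (anyDigits bss) (isFresh z)) (roundTape n z (map (consumeDigit true) bss)))
    (nextHeader-at0 n) (round-pass n (at 0 n) bss refl)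

  valid-startHeader : ∀ k → k ≡ n → Valid n (startHeader k)
  valid-startHeader zero e = tt
  valid-startHeader (suc k) e = e

  term-cycle-run : ∀ h bss → StartHeader n h → All ReadyOrIdle bss → Any Ready bss → μs bss ≤ W →
    Run passBound (Hd0 (isFresh h)) (roundTape n h bss) (Hd0 true) (roundTape n fresh (map termCycle bss)) (suc n)
  term-cycle-run h bss st ri rd hm =
    run-pass tr1 (rounds≤passBound h (startHeader n) bss (map (consumeDigit true) bss) (valid-StartHeader h st) (valid-startHeader n refl) hm hm1)
      (subst (λ z → Run passBound (Hd0 (isFresh (startHeader n))) (roundTape n (startHeader n) (map (consumeDigit true) bss)) (Hd0 true) (roundTape n fresh z) n)
        (all-termCycle bss ri)
        (remaining-rounds n refl (map (consumeDigit true) bss) ok hm1))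
    where
    hm1 = ≤-trans (μs-step true bss) hm
    a0 : anyDigits bss ≡ true
    conv : ∀ {bss} → Any Ready bss → Any (λ b → hasDigits b ≡ true) bss
    conv (here p) = here (hasDigits-ready _ p)
    conv (there p) = there (conv p)
    a0 = anyDigits-any bss (conv rd)
    tr1 : Pass (Hd0 (isFresh h)) (roundTape n h bss) (Hd0 (isFresh (startHeader n))) (roundTape n (startHeader n) (map (consumeDigit true) bss))
    tr1 = subst (λ z → Pass (Hd0 (isFresh h)) (roundTape n h bss) (afterBlocks z (isFresh (startHeader n))) (roundTape n (startHeader n) (map (consumeDigit true) bss))) a0 (first-round h bss st)
    ok : ∀ i → i < n → anyDigits (map (consumeExponents i) (map (consumeDigit true) bss)) ≡ true
    ok i p = trans (cong anyDigits (sym (LP.map-∘ bss)))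
      (anyDigits-any (map (consumeExponents i ∘ consumeDigit true) bss) (Any-map (consumeExponents i ∘ consumeDigit true) (λ {b} r → hasDigits-ready-consumeExponents b r i p) rd))

  final-run : ∀ h bss → StartHeader n h → All Idle bss → μs bss ≤ W →
    Run passBound (Hd0 (isFresh h)) (roundTape n h bss) Halt (replicate n D1 ++ SH ∷ concatMap blockOutput bss) 2
  final-run h bss st idl hm =
    run-pass tr1 (rounds≤passBound h (startHeader n) bss bss (valid-StartHeader h st) vn hm hm)
      (run-pass tr2 sz rdone)
    where
    vn = valid-startHeader n refl
    tr1 : Pass (Hd0 (isFresh h)) (roundTape n h bss) (Fn0 (isFresh (startHeader n))) (roundTape n (startHeader n) bss)
    tr1 = subst₂ (λ z y → Pass (Hd0 (isFresh h)) (roundTape n h bss) (afterBlocks z (isFresh (startHeader n))) (roundTape n (startHeader n) y))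
            (anyDigits-idle bss idl) (map-consumeDigit-idle true bss idl) (first-round h bss st)
    tr2 = final-pass n (startHeader n) bss vn idl
    sz : length (roundTape n (startHeader n) bss) + length (replicate n D1 ++ SH ∷ concatMap blockOutput bss) ≤ passBound
    sz = ≤-trans (+-mono-≤ (len-roundTape n W (startHeader n) bss vn hm) (≤-trans (len-finalOutput n (startHeader n) bss vn idl) (*-monoʳ-≤ 6 (len-roundTape n W (startHeader n) bss vn hm))))
           (≤-reflexive refl)

flattenTerms : List ListTerm → List ℤ₃
flattenTerms [] = []
flattenTerms ((c , es) ∷ ts) = c ∷ es ++ flattenTerms ts

AllArity : ℕ → List ListTerm → Set
AllArity n ts = All (λ t → length (proj₂ t) ≡ n) ts

drop-suc-[] : ∀ {A : Set} a (xs : List A) → drop a xs ≡ [] → drop (suc a) xs ≡ []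
drop-suc-[] zero [] e = refl
drop-suc-[] (suc a) [] e = refl
drop-suc-[] (suc a) (x ∷ xs) e = drop-suc-[] a xs e

take-suc-[] : ∀ {A : Set} a (xs : List A) → drop a xs ≡ [] → take (suc a) xs ≡ take a xs
take-suc-[] zero [] e = refl
take-suc-[] (suc a) [] e = refl
take-suc-[] (suc a) (x ∷ xs) e = cong (x ∷_) (take-suc-[] a xs e)

take-suc-∷ : ∀ {A : Set} a (xs : List A) {y ys} → drop a xs ≡ y ∷ ys → take (suc a) xs ≡ take a xs ++ y ∷ []
take-suc-∷ zero (x ∷ xs) refl = refl
take-suc-∷ (suc a) (x ∷ xs) e = cong (x ∷_) (take-suc-∷ a xs e)

All-drop : ∀ {A : Set} {P : A → Set} a {xs : List A} → All P xs → All P (drop a xs)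
All-drop zero p = p
All-drop (suc a) [] = []
All-drop (suc a) (p ∷ ps) = All-drop a ps

drop-< : ∀ {A : Set} a (xs : List A) → a < length xs → Σ A λ y → Σ (List A) λ ys → drop a xs ≡ y ∷ ys
drop-< zero (x ∷ xs) p = x , xs , refl
drop-< (suc a) (x ∷ xs) (s≤s p) = drop-< a xs p

Run-++ : ∀ {passBound q w q' w' q'' w'' p p'} → Run passBound q w q' w' p → Run passBound q' w' q'' w'' p' → Run passBound q w q'' w'' (p + p')
Run-++ rdone r2 = r2
Run-++ (rpass tr sz r1) r2 = rpass tr sz (Run-++ r1 r2)

module _ (n W : ℕ) where

  blockAfter : ℕ → List ListTerm → Block
  blockAfter zero ts = initialBlock (flattenTerms ts)
  blockAfter (suc a) ts = termCycle n W (blockAfter a ts)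

  termCycle-∷ : ∀ b c r → pending b ≡ c ∷ r → termCycle n W b ≡ block (drop n r) (finished b ++ fromMaybe (active b)) (just (c , take n r))
  termCycle-∷ (block .(c ∷ r) d a) c r refl = refl

  termCycle-[] : ∀ b → pending b ≡ [] → termCycle n W b ≡ b
  termCycle-[] (block .[] d a) refl = refl

  blockAfter-invariant : ∀ a ts → AllArity n ts → (pending (blockAfter a ts) ≡ flattenTerms (drop a ts)) × (finished (blockAfter a ts) ++ fromMaybe (active (blockAfter a ts)) ≡ take a ts)
  blockAfter-invariant zero ts an = refl , refl
  blockAfter-invariant (suc a) ts an with drop a ts in eq | All-drop a an | blockAfter-invariant a ts an
  ... | [] | _ | r , c = trans (cong pending (termCycle-[] (blockAfter a ts) r)) (trans r (cong flattenTerms (sym (drop-suc-[] a ts eq))))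
                       , trans (cong (λ b → finished b ++ fromMaybe (active b)) (termCycle-[] (blockAfter a ts) r)) (trans c (sym (take-suc-[] a ts eq)))
  ... | (c0 , es) ∷ ts' | (ln ∷ _) | r , c =
      trans (cong pending (termCycle-∷ (blockAfter a ts) c0 (es ++ flattenTerms ts') r))
        (trans (subst (λ k → drop k (es ++ flattenTerms ts') ≡ flattenTerms ts') ln (drop-length-++ es (flattenTerms ts'))) (cong flattenTerms (sym (drop-suc a ts eq))))
    , trans (cong (λ b → finished b ++ fromMaybe (active b)) (termCycle-∷ (blockAfter a ts) c0 (es ++ flattenTerms ts') r))
        (trans (cong₂ (λ u v → u ++ (c0 , v) ∷ []) c (subst (λ k → take k (es ++ flattenTerms ts') ≡ es) ln (take-length-++ es (flattenTerms ts'))))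
               (sym (take-suc-∷ a ts eq)))

  ready-blockAfter : ∀ a ts → AllArity n ts → a < length ts → Ready n W (blockAfter a ts)
  ready-blockAfter a ts an lt with drop-< a ts lt
  ... | (c0 , es) , ts' , eq with All-drop a an
  ...   | an' rewrite eq with an'
  ...     | ln ∷ _ = c0 , es , flattenTerms ts' , trans (proj₁ (blockAfter-invariant a ts an)) (cong flattenTerms eq) , ln

  idle-blockAfter : ∀ a ts → AllArity n ts → length ts ≤ a → Idle (blockAfter a ts)
  idle-blockAfter a ts an le = trans (proj₁ (blockAfter-invariant a ts an)) (cong flattenTerms (LP.drop-all a ts le))

  readyOrIdle-blockAfter : ∀ a ts → AllArity n ts → ReadyOrIdle n W (blockAfter a ts)
  readyOrIdle-blockAfter a ts an with length ts ≤? a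
  ... | yes le = inj₂ (idle-blockAfter a ts an le)
  ... | no nle = inj₁ (ready-blockAfter a ts an (≰⇒> nle))

  blockOutput-blockAfter : ∀ a ts → AllArity n ts → length ts ≤ a → blockOutput (blockAfter a ts) ≡ wordOutput ts
  blockOutput-blockAfter a ts an le = cong wordOutput (trans (proj₂ (blockAfter-invariant a ts an)) (LP.take-all a ts le))

  μ-blockAfter : ∀ a ts → AllArity n ts → μ (blockAfter a ts) ≤ μ (blockAfter 0 ts)
  μ-blockAfter zero ts an = ≤-refl
  μ-blockAfter (suc a) ts an = ≤-trans (≤-reflexive (cong μ (sym (termCycle-readyOrIdle n W (blockAfter a ts) (readyOrIdle-blockAfter a ts an)))))
    (≤-trans (μ-consumeExponents n (consumeDigit true (blockAfter a ts))) (≤-trans (μ-step true (blockAfter a ts)) (μ-blockAfter a ts an)))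

  μs-blockAfter : ∀ a tss → All (AllArity n) tss → μs (map (blockAfter a) tss) ≤ μs (map (blockAfter 0) tss)
  μs-blockAfter a [] [] = ≤-refl
  μs-blockAfter a (ts ∷ tss) (an ∷ ans) = +-mono-≤ (μ-blockAfter a ts an) (μs-blockAfter a tss ans)

  finalOut : List (List ListTerm) → List Γ
  finalOut tss = replicate n D1 ++ SH ∷ concatMap wordOutput tss

  all-done-or-some-left : ∀ a (tss : List (List ListTerm)) → All (λ ts → length ts ≤ a) tss ⊎ Any (λ ts → a < length ts) tss
  all-done-or-some-left a [] = inj₁ []
  all-done-or-some-left a (ts ∷ tss) with length ts ≤? a | all-done-or-some-left a tss
  ... | yes le | inj₁ al = inj₁ (le ∷ al)
  ... | yes le | inj₂ an = inj₂ (there an)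
  ... | no nle | _ = inj₂ (here (≰⇒> nle))

  all-readyOrIdle-blockAfter : ∀ a tss → All (AllArity n) tss → All (ReadyOrIdle n W) (map (blockAfter a) tss)
  all-readyOrIdle-blockAfter a [] [] = []
  all-readyOrIdle-blockAfter a (ts ∷ tss) (an ∷ ans) = readyOrIdle-blockAfter a ts an ∷ all-readyOrIdle-blockAfter a tss ans

  any-ready-blockAfter : ∀ a tss → All (AllArity n) tss → Any (λ ts → a < length ts) tss → Any (Ready n W) (map (blockAfter a) tss)
  any-ready-blockAfter a (ts ∷ tss) (an ∷ ans) (here lt) = here (ready-blockAfter a ts an lt)
  any-ready-blockAfter a (ts ∷ tss) (an ∷ ans) (there p) = there (any-ready-blockAfter a tss ans p)

  all-idle-blockAfter : ∀ a tss → All (AllArity n) tss → All (λ ts → length ts ≤ a) tss → All Idle (map (blockAfter a) tss)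
  all-idle-blockAfter a [] [] [] = []
  all-idle-blockAfter a (ts ∷ tss) (an ∷ ans) (le ∷ les) = idle-blockAfter a ts an le ∷ all-idle-blockAfter a tss ans les

  blockOutputs-blockAfter : ∀ a tss → All (AllArity n) tss → All (λ ts → length ts ≤ a) tss → concatMap blockOutput (map (blockAfter a) tss) ≡ concatMap wordOutput tss
  blockOutputs-blockAfter a [] [] [] = refl
  blockOutputs-blockAfter a (ts ∷ tss) (an ∷ ans) (le ∷ les) = cong₂ _++_ (blockOutput-blockAfter a ts an le) (blockOutputs-blockAfter a tss ans les)

  no-term-left : ∀ a (tss : List (List ListTerm)) → All (λ ts → length ts ≤ a + 0) tss → Any (λ ts → a < length ts) tss → ⊥
  no-term-left a (ts ∷ tss) (le ∷ _) (here lt) = <⇒≱ lt (≤-trans le (≤-reflexive (+-identityʳ a)))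
  no-term-left a (ts ∷ tss) (_ ∷ les) (there p) = no-term-left a tss les p

  HaltingRun : ℕ → ℕ → Header → List (List ListTerm) → Set
  HaltingRun K a h tss = Σ ℕ λ P → (P ≤ K * suc n + 2) × Run (passBound n W) (Hd0 (isFresh h)) (roundTape n h (map (blockAfter a) tss)) Halt (finalOut tss) P

  mutual
    run-cycles : ∀ K a h tss → StartHeader n h → All (AllArity n) tss → All (λ ts → length ts ≤ a + K) tss →
      μs (map (blockAfter 0) tss) ≤ W → HaltingRun K a h tss
    run-cycles K a h tss st ans bnd hm with all-done-or-some-left a tss
    ... | inj₁ al = 2 , m≤n+m 2 (K * suc n) ,
          subst (λ z → Run (passBound n W) (Hd0 (isFresh h)) (roundTape n h (map (blockAfter a) tss)) Halt (replicate n D1 ++ SH ∷ z) 2)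
            (blockOutputs-blockAfter a tss ans al)
            (final-run n W h (map (blockAfter a) tss) st (all-idle-blockAfter a tss ans al) (≤-trans (μs-blockAfter a tss ans) hm))
    ... | inj₂ an = run-cycle K a h tss st ans bnd hm an

    run-cycle : ∀ K a h tss → StartHeader n h → All (AllArity n) tss → All (λ ts → length ts ≤ a + K) tss →
      μs (map (blockAfter 0) tss) ≤ W → Any (λ ts → a < length ts) tss → HaltingRun K a h tss
    run-cycle zero a h tss st ans bnd hm an = ⊥-elim (no-term-left a tss bnd an)
    run-cycle (suc K') a h tss st ans bnd hm an =
      suc n + proj₁ rec , pb' ,
      Run-++ (subst (λ z → Run (passBound n W) (Hd0 (isFresh h)) (roundTape n h (map (blockAfter a) tss)) (Hd0 true) (roundTape n fresh z) (suc n))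
                (sym (LP.map-∘ tss))
                (term-cycle-run n W h (map (blockAfter a) tss) st (all-readyOrIdle-blockAfter a tss ans) (any-ready-blockAfter a tss ans an) (≤-trans (μs-blockAfter a tss ans) hm)))
             (proj₂ (proj₂ rec))
      where
      bnd' : All (λ ts → length ts ≤ suc a + K') tss
      bnd' = Data.List.Relation.Unary.All.map (λ le → ≤-trans le (≤-reflexive (+-suc a K'))) bnd
      rec = run-cycles K' (suc a) fresh tss (inj₁ refl) ans bnd' hm
      pb' : suc n + proj₁ rec ≤ suc K' * suc n + 2
      pb' = ≤-trans (+-monoʳ-≤ (suc n) (proj₁ (proj₂ rec))) (≤-reflexive (sym (+-assoc (suc n) (K' * suc n) 2)))

-- Running time

timeExponent : ℕ
timeExponent = 18

final-bound : ∀ Lb n P → n + 2 ≤ Lb → P ≤ Lb * suc n + 2 →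
  (2 + P) * (passBound n Lb * (2 * passBound n Lb + 3)) ≤ timeExponent * suc Lb ^ timeExponent
final-bound Lb n P n+2≤Lb P≤ =
  ≤-trans (*-mono-≤ 2+P≤ (*-mono-≤ pass≤ 2pass+3≤))
  (≤-trans (≤-reflexive (collect (X * X)))
  (≤-trans (*-mono-≤ 239470≤X¹² (≤-reflexive (sixth-power X)))
  (≤-trans (≤-reflexive (sym (^-distribˡ-+-* X 12 6))) (m≤m+n (X ^ 18) (17 * X ^ 18)))))
  where
  X = suc Lb
  Lb≤X : Lb ≤ X
  Lb≤X = n≤1+n Lb
  X≤X² : X ≤ X * X
  X≤X² = m≤m*n X X
  1≤X² : 1 ≤ X * X
  1≤X² = ≤-trans (s≤s z≤n) X≤X²
  round≤ : roundBound n Lb ≤ 22 * (X * X)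
  round≤ = ≤-trans (+-mono-≤ (+-monoˡ-≤ 3 (≤-trans (m≤m+n n 2) (≤-trans n+2≤Lb Lb≤X)))
                             (*-mono-≤ Lb≤X (+-monoˡ-≤ 12 (*-monoʳ-≤ 6 Lb≤X))))
           (≤-trans (≤-reflexive (expand X))
           (≤-trans (+-monoˡ-≤ (3 * 1) (+-monoʳ-≤ (6 * (X * X)) (*-monoʳ-≤ 13 X≤X²)))
           (≤-trans (+-monoʳ-≤ (6 * (X * X) + 13 * (X * X)) (*-monoʳ-≤ 3 1≤X²)) (≤-reflexive (sum (X * X))))))
    where
    expand : ∀ X → X + 3 + X * (6 * X + 12) ≡ 6 * (X * X) + 13 * X + 3 * 1
    expand = solve-∀
    sum : ∀ Y → 6 * Y + 13 * Y + 3 * Y ≡ 22 * Y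
    sum = solve-∀
  pass≤ : passBound n Lb ≤ 154 * (X * X)
  pass≤ = ≤-trans (*-monoʳ-≤ 7 round≤) (≤-reflexive (sym (*-assoc 7 22 (X * X))))
  2pass+3≤ : 2 * passBound n Lb + 3 ≤ 311 * (X * X)
  2pass+3≤ = ≤-trans (+-mono-≤ (*-monoʳ-≤ 2 pass≤) (*-monoʳ-≤ 3 1≤X²)) (≤-reflexive (sum (X * X)))
    where
    sum : ∀ Y → 2 * (154 * Y) + 3 * Y ≡ 311 * Y
    sum = solve-∀
  2+P≤ : 2 + P ≤ 5 * (X * X)
  2+P≤ = ≤-trans (+-monoʳ-≤ 2 P≤)
         (≤-trans (≤-reflexive (shuffle (Lb * suc n)))
         (≤-trans (+-mono-≤ (*-monoʳ-≤ 4 1≤X²) (*-mono-≤ Lb≤X (≤-trans (≤-reflexive (+-comm 1 n)) (≤-trans (+-monoʳ-≤ n (s≤s z≤n)) (≤-trans n+2≤Lb Lb≤X)))))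
                  (≤-reflexive (sum (X * X)))))
    where
    shuffle : ∀ a → 2 + (a + 2) ≡ 4 * 1 + a
    shuffle = solve-∀
    sum : ∀ Y → 4 * Y + Y ≡ 5 * Y
    sum = solve-∀
  collect : ∀ Y → 5 * Y * (154 * Y * (311 * Y)) ≡ 239470 * (Y * (Y * Y))
  collect = solve-∀
  sixth-power : ∀ X → (X * X) * ((X * X) * (X * X)) ≡ X * (X * (X * (X * (X * (X * 1)))))
  sixth-power = solve-∀
  239470≤X¹² : 239470 ≤ X ^ 12
  239470≤X¹² = ≤-trans (≤ᵇ⇒≤ 239470 (3 ^ 12) _) (^-monoˡ-≤ 12 (s≤s (≤-trans (m≤n+m 2 n) n+2≤Lb)))

-- The input and output encodings

polyTerms : ∀ {n} → Poly n → List ListTerm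
polyTerms p = map (λ t → proj₁ t , V.toList (proj₂ t)) p

inputSym-unary : ∀ m → map inputSym (unary m) ≡ replicate m D1
inputSym-unary zero = refl
inputSym-unary (suc m) = cong (D1 ∷_) (inputSym-unary m)

inputSym-digit : ∀ c → inputSym (digit c) ≡ digitSym c
inputSym-digit fz = refl
inputSym-digit (fs fz) = refl
inputSym-digit (fs (fs fz)) = refl

inputSym-digits : ∀ {m} (es : Vec ℤ₃ m) → map inputSym (V.toList (V.map digit es)) ≡ map digitSym (V.toList es)
inputSym-digits [] = refl
inputSym-digits (e ∷ es) = cong₂ _∷_ (inputSym-digit e) (inputSym-digits es)

inputSym-terms : ∀ {n} (p : Poly n) → map inputSym (concatMap encTerm p) ≡ map digitSym (flattenTerms (polyTerms p))
inputSym-terms [] = refl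
inputSym-terms ((c , es) ∷ p) = begin
    map inputSym ((digit c ∷ V.toList (V.map digit es)) ++ concatMap encTerm p) ≡⟨ LP.map-++ inputSym (digit c ∷ V.toList (V.map digit es)) _ ⟩
    inputSym (digit c) ∷ map inputSym (V.toList (V.map digit es)) ++ map inputSym (concatMap encTerm p)
      ≡⟨ cong₂ _∷_ (inputSym-digit c) (cong₂ _++_ (inputSym-digits es) (inputSym-terms p)) ⟩
    digitSym c ∷ map digitSym (V.toList es) ++ map digitSym (flattenTerms (polyTerms p)) ≡⟨ cong (digitSym c ∷_) (sym (LP.map-++ digitSym (V.toList es) _)) ⟩
    map digitSym (flattenTerms (polyTerms ((c , es) ∷ p))) ∎
  where open ≡-Reasoning

inputSym-poly : ∀ {n} (p : Poly n) → map inputSym (encPoly p) ≡ map digitSym (flattenTerms (polyTerms p)) ++ TR ∷ []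
inputSym-poly p = trans (LP.map-++ inputSym (concatMap encTerm p) (▹ ∷ [])) (cong (_++ TR ∷ []) (inputSym-terms p))

inputSym-polys : ∀ {n} (ps : List (Poly n)) → map inputSym (concatMap encPoly ps) ≡ digitBlocks (map flattenTerms (map polyTerms ps))
inputSym-polys [] = refl
inputSym-polys (p ∷ ps) = trans (LP.map-++ inputSym (encPoly p) (concatMap encPoly ps)) (cong₂ _++_ (inputSym-poly p) (inputSym-polys ps))

termLists : (e : InstA) → List (List ListTerm)
termLists e = map polyTerms (V.toList (polys e))

inputTape : InstA → List Γ
inputTape e = replicate (k e) D1 ++ SH ∷ replicate (n e) D1 ++ SH ∷ digitBlocks (map flattenTerms (termLists e))

inputSym-encA : ∀ e → map inputSym (encA e) ≡ inputTape e
inputSym-encA e = begin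
    map inputSym (unary (k e) ++ ♯ ∷ unary (n e) ++ ♯ ∷ concatMap encPoly (V.toList (polys e)))
      ≡⟨ LP.map-++ inputSym (unary (k e)) _ ⟩
    map inputSym (unary (k e)) ++ SH ∷ map inputSym (unary (n e) ++ ♯ ∷ concatMap encPoly (V.toList (polys e)))
      ≡⟨ cong₂ (λ a b → a ++ SH ∷ b) (inputSym-unary (k e)) (LP.map-++ inputSym (unary (n e)) _) ⟩
    replicate (k e) D1 ++ SH ∷ map inputSym (unary (n e)) ++ SH ∷ map inputSym (concatMap encPoly (V.toList (polys e)))
      ≡⟨ cong₂ (λ a b → replicate (k e) D1 ++ SH ∷ a ++ SH ∷ b) (inputSym-unary (n e)) (inputSym-polys (V.toList (polys e))) ⟩
    inputTape e ∎
  where open ≡-Reasoning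

cubeLetters-enc : ∀ {N} e (i : Fin N) → map inputSym (concatMap encLetter (cubeLetters e i)) ≡ concatMap outputSyms (cubeSyms e (toℕ i))
cubeLetters-enc fz i = refl
cubeLetters-enc (fs (fs fz)) i = refl
cubeLetters-enc (fs fz) i = begin
    map inputSym (V1 ++ V1 ++ V1 ++ []) ≡⟨ cong (λ z → map inputSym (V1 ++ V1 ++ z)) (LP.++-identityʳ V1) ⟩
    map inputSym (V1 ++ V1 ++ V1) ≡⟨ trans (LP.map-++ inputSym V1 _) (cong (map inputSym V1 ++_) (LP.map-++ inputSym V1 V1)) ⟩
    map inputSym V1 ++ map inputSym V1 ++ map inputSym V1 ≡⟨ cong (λ z → z ++ z ++ z) one ⟩
    concatMap outputSyms (varSyms m) ++ concatMap outputSyms (varSyms m) ++ concatMap outputSyms (varSyms m)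
      ≡⟨ sym (trans (LP.concatMap-++ outputSyms (varSyms m) _) (cong (concatMap outputSyms (varSyms m) ++_) (LP.concatMap-++ outputSyms (varSyms m) (varSyms m)))) ⟩
    concatMap outputSyms (varSyms m ++ varSyms m ++ varSyms m) ∎
  where
  open ≡-Reasoning
  m = toℕ i
  V1 = encLetter (var i)
  reps : ∀ m → map inputSym (unary m) ≡ concatMap outputSyms (replicate m A1)
  reps zero = refl
  reps (suc m) = cong (D1 ∷_) (reps m)
  one : map inputSym V1 ≡ concatMap outputSyms (varSyms m)
  one = cong (D2 ∷_) (trans (LP.map-++ inputSym (unary m) (d0 ∷ [])) (trans (cong (_++ D0 ∷ []) (reps m))
          (sym (trans (LP.concatMap-++ outputSyms (replicate m A1) (A0 ∷ [])) refl))))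

reassoc : ∀ (g F G' : List Γ) x → (g ++ F) ++ x ∷ (G' ++ g) ≡ g ++ (F ++ x ∷ G') ++ g
reassoc g F G' x = begin
    (g ++ F) ++ x ∷ (G' ++ g) ≡⟨ LP.++-assoc g F _ ⟩
    g ++ (F ++ x ∷ (G' ++ g)) ≡⟨ cong (g ++_) (sym (LP.++-assoc F (x ∷ G') g)) ⟩
    g ++ (F ++ x ∷ G') ++ g ∎
  where open ≡-Reasoning

encα-centreSym : ∀ {N} c → map inputSym (encLetter {N} (cst (αᴳ c)) ++ []) ≡ concatMap outputSyms (centreSym c ∷ [])
encα-centreSym fz = refl
encα-centreSym (fs fz) = refl
encα-centreSym (fs (fs fz)) = refl

termLetters-enc : ∀ {N m} (ι : Fin m → Fin N) → (∀ i → toℕ (ι i) ≡ m ∸ suc (toℕ i)) → ∀ c (es : Vec ℤ₃ m) →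
        map inputSym (concatMap encLetter (termLetters ι c es)) ≡ concatMap outputSyms (termSyms (c , V.toList es))
termLetters-enc {N} ι h c [] = encα-centreSym {N} c
termLetters-enc {N} {suc m} ι h c (e ∷ es) = begin
    map inputSym (concatMap encLetter (g ++ termLetters (ι ∘ fs) c es ++ g))
      ≡⟨ cong (map inputSym) (trans (LP.concatMap-++ encLetter g _) (cong (concatMap encLetter g ++_) (LP.concatMap-++ encLetter (termLetters (ι ∘ fs) c es) g))) ⟩
    map inputSym (EG ++ ET ++ EG) ≡⟨ trans (LP.map-++ inputSym EG _) (cong (map inputSym EG ++_) (LP.map-++ inputSym ET EG)) ⟩
    map inputSym EG ++ map inputSym ET ++ map inputSym EG
      ≡⟨ cong₂ (λ a b → a ++ b ++ a) (trans (cubeLetters-enc e (ι fz)) (cong (λ z → concatMap outputSyms (cubeSyms e z)) hz)) (termLetters-enc (ι ∘ fs) (λ i → h (fs i)) c es) ⟩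
    concatMap outputSyms (cubeSyms e len) ++ concatMap outputSyms (termSyms (c , Ls)) ++ concatMap outputSyms (cubeSyms e len)
      ≡⟨ sym (trans (LP.concatMap-++ outputSyms (cubeSyms e len) _) (cong (concatMap outputSyms (cubeSyms e len) ++_) (LP.concatMap-++ outputSyms (termSyms (c , Ls)) (cubeSyms e len)))) ⟩
    concatMap outputSyms (cubeSyms e len ++ termSyms (c , Ls) ++ cubeSyms e len) ≡⟨ cong (concatMap outputSyms) (sym (reassoc (cubeSyms e len) (leftCubes 0 Ls) (rightCubes 0 Ls) (centreSym c))) ⟩
    concatMap outputSyms (termSyms (c , e ∷ Ls)) ∎
  where
  open ≡-Reasoning
  g = cubeLetters e (ι fz)
  EG = concatMap encLetter g
  ET = concatMap encLetter (termLetters (ι ∘ fs) c es)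
  Ls = V.toList es
  len = length Ls
  hz : toℕ (ι fz) ≡ len
  hz = trans (h fz) (sym (VP.length-toList es))

termLetters-nonEmpty : ∀ {N m} (ι : Fin m → Fin N) c es → Σ (Letter N) λ x → Σ (List (Letter N)) λ xs → termLetters ι c es ≡ x ∷ xs
termLetters-nonEmpty ι c [] = cst (αᴳ c) , [] , refl
termLetters-nonEmpty ι c (e ∷ es) with cubeLetters e (ι fz) | termLetters-nonEmpty (ι ∘ fs) c es
... | [] | x , xs , eq = x , xs ++ [] , cong (_++ []) eq
... | y ∷ ys | _ = y , ys ++ termLetters (ι ∘ fs) c es ++ y ∷ ys , refl

termWord-enc : ∀ {n} (t : Term n) → map inputSym (concatMap encLetter (termWord t)) ≡ termOutput (proj₁ t , V.toList (proj₂ t))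
termWord-enc (c , es) = termLetters-enc opposite FinP.opposite-prop c es

polyLetters-enc : ∀ {n} (p : Poly n) → map inputSym (concatMap encLetter (concatMap termWord p)) ≡ concatMap termOutput (polyTerms p)
polyLetters-enc [] = refl
polyLetters-enc (t ∷ p) = trans (cong (map inputSym) (LP.concatMap-++ encLetter (termWord t) (concatMap termWord p)))
  (trans (LP.map-++ inputSym (concatMap encLetter (termWord t)) _) (cong₂ _++_ (termWord-enc t) (polyLetters-enc p)))

polyWord-enc : ∀ {n} (p : Poly n) → map inputSym (encWord (polyWord p)) ≡ wordOutput (polyTerms p)
polyWord-enc [] = refl
polyWord-enc (t ∷ p) with termLetters-nonEmpty opposite (proj₁ t) (proj₂ t)
... | x , xs , eq = begin
    map inputSym (encWord (nonEmpty (termWord t ++ concatMap termWord p)))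
      ≡⟨ cong (λ z → map inputSym (encWord (nonEmpty (z ++ concatMap termWord p)))) eq ⟩
    map inputSym (concatMap encLetter (x ∷ xs ++ concatMap termWord p) ++ ▹ ∷ [])
      ≡⟨ cong (λ z → map inputSym (concatMap encLetter (z ++ concatMap termWord p) ++ ▹ ∷ [])) (sym eq) ⟩
    map inputSym (concatMap encLetter (concatMap termWord (t ∷ p)) ++ ▹ ∷ [])
      ≡⟨ trans (LP.map-++ inputSym (concatMap encLetter (concatMap termWord (t ∷ p))) (▹ ∷ [])) (cong (_++ TR ∷ []) (polyLetters-enc (t ∷ p))) ⟩
    wordOutput (polyTerms (t ∷ p)) ∎
  where open ≡-Reasoning

polyWords-enc : ∀ {n} (ps : List (Poly n)) → map inputSym (concatMap encWord (map polyWord ps)) ≡ concatMap wordOutput (map polyTerms ps)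
polyWords-enc [] = refl
polyWords-enc (p ∷ ps) = trans (LP.map-++ inputSym (encWord (polyWord p)) _) (cong₂ _++_ (polyWord-enc p) (polyWords-enc ps))

inputSym-encB : ∀ e → map inputSym (encB (reduce e)) ≡ finalOut (n e) 0 (termLists e)
inputSym-encB e = begin
    map inputSym (unary (n e) ++ ♯ ∷ concatMap encWord (V.toList (V.map polyWord (polys e))))
      ≡⟨ LP.map-++ inputSym (unary (n e)) _ ⟩
    map inputSym (unary (n e)) ++ SH ∷ map inputSym (concatMap encWord (V.toList (V.map polyWord (polys e))))
      ≡⟨ cong₂ (λ a b → a ++ SH ∷ b) (inputSym-unary (n e))
           (trans (cong (λ z → map inputSym (concatMap encWord z)) (VP.toList-map polyWord (polys e))) (polyWords-enc (V.toList (polys e)))) ⟩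
    replicate (n e) D1 ++ SH ∷ concatMap wordOutput (termLists e) ∎
  where open ≡-Reasoning

arity-polyTerms : ∀ {N} (p : Poly N) → AllArity N (polyTerms p)
arity-polyTerms [] = []
arity-polyTerms ((c , es) ∷ p) = VP.length-toList es ∷ arity-polyTerms p

arity-termLists : ∀ {N} (ps : List (Poly N)) → All (AllArity N) (map polyTerms ps)
arity-termLists [] = []
arity-termLists (p ∷ ps) = arity-polyTerms p ∷ arity-termLists ps

digitBlocksLength : List (List ListTerm) → ℕ
digitBlocksLength tss = length (digitBlocks (map flattenTerms tss))

length≤length-flattenTerms : ∀ ts → length ts ≤ length (flattenTerms ts)
length≤length-flattenTerms [] = z≤n
length≤length-flattenTerms ((c , es) ∷ ts) = s≤s (≤-trans (length≤length-flattenTerms ts) (≤-trans (m≤n+m _ (length es)) (≤-reflexive (sym (LP.length-++ es)))))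

length-digitBlock : ∀ ts → length (map digitSym (flattenTerms ts) ++ TR ∷ []) ≡ length (flattenTerms ts) + 1
length-digitBlock ts = trans (LP.length-++ (map digitSym (flattenTerms ts))) (cong (_+ 1) (LP.length-map digitSym (flattenTerms ts)))

termCount≤digitBlocksLength : ∀ tss → All (λ ts → length ts ≤ digitBlocksLength tss) tss
termCount≤digitBlocksLength [] = []
termCount≤digitBlocksLength (ts ∷ tss) = here' ∷ Data.List.Relation.Unary.All.map (λ le → ≤-trans le (≤-trans (m≤n+m (digitBlocksLength tss) (length (map digitSym (flattenTerms ts) ++ TR ∷ []))) (≤-reflexive (sym eq)))) rest'
  where
  eq : digitBlocksLength (ts ∷ tss) ≡ length (map digitSym (flattenTerms ts) ++ TR ∷ []) + digitBlocksLength tss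
  eq = LP.length-++ (map digitSym (flattenTerms ts) ++ TR ∷ [])
  here' : length ts ≤ digitBlocksLength (ts ∷ tss)
  here' = ≤-trans (length≤length-flattenTerms ts) (≤-trans (≤-trans (m≤m+n _ 1) (≤-reflexive (sym (length-digitBlock ts)))) (≤-trans (m≤m+n _ (digitBlocksLength tss)) (≤-reflexive (sym eq))))
  rest' : All (λ ts' → length ts' ≤ digitBlocksLength tss) tss
  rest' = termCount≤digitBlocksLength tss

μs-initialBlocks : ∀ N W tss → μs (map (blockAfter N W 0) tss) ≡ digitBlocksLength tss + length tss
μs-initialBlocks N W [] = refl
μs-initialBlocks N W (ts ∷ tss) = begin
    length (flattenTerms ts) + 0 + 2 + μs (map (blockAfter N W 0) tss) ≡⟨ cong (length (flattenTerms ts) + 0 + 2 +_) (μs-initialBlocks N W tss) ⟩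
    length (flattenTerms ts) + 0 + 2 + (digitBlocksLength tss + length tss) ≡⟨ ar (length (flattenTerms ts)) (digitBlocksLength tss) (length tss) ⟩
    length (flattenTerms ts) + 1 + digitBlocksLength tss + suc (length tss) ≡⟨ cong (λ z → z + digitBlocksLength tss + suc (length tss)) (sym (length-digitBlock ts)) ⟩
    length B1 + digitBlocksLength tss + suc (length tss) ≡⟨ cong (_+ suc (length tss)) (sym (LP.length-++ B1)) ⟩
    digitBlocksLength (ts ∷ tss) + length (ts ∷ tss) ∎
  where
  open ≡-Reasoning
  B1 = map digitSym (flattenTerms ts) ++ TR ∷ []
  ar : ∀ x b l → x + 0 + 2 + (b + l) ≡ x + 1 + b + suc l
  ar = solve-∀

len-inputTape : ∀ e → length (inputTape e) ≡ digitBlocksLength (termLists e) + k e + n e + 2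
len-inputTape e = trans (LP.length-++ (replicate (k e) D1))
  (trans (cong₂ (λ a b → a + suc b) (LP.length-replicate (k e))
            (trans (LP.length-++ (replicate (n e) D1)) (cong (λ z → z + suc (digitBlocksLength (termLists e))) (LP.length-replicate (n e)))))
         (ar (k e) (n e) (digitBlocksLength (termLists e))))
  where
  ar : ∀ k n S → k + suc (n + suc S) ≡ S + k + n + 2
  ar = solve-∀

length-termLists : ∀ e → length (termLists e) ≡ k e
length-termLists e = trans (LP.length-map polyTerms (V.toList (polys e))) (VP.length-toList (polys e))

initialBlocks : InstA → List Block
initialBlocks e = map (blockAfter (n e) (length (encA e)) 0) (termLists e)

module _ (e : InstA) where

  length-inputTape : length (inputTape e) ≡ length (encA e)
  length-inputTape = trans (cong length (sym (inputSym-encA e))) (LP.length-map inputSym (encA e))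

  length-encA : length (encA e) ≡ μs (initialBlocks e) + n e + 2
  length-encA = trans (sym length-inputTape) (trans (len-inputTape e)
    (cong (λ z → z + n e + 2) (trans (cong (digitBlocksLength (termLists e) +_) (sym (length-termLists e))) (sym (μs-initialBlocks (n e) (length (encA e)) (termLists e))))))

  weight≤inputLength : μs (initialBlocks e) ≤ length (encA e)
  weight≤inputLength = ≤-trans (m≤m+n _ (n e)) (≤-trans (m≤m+n _ 2) (≤-reflexive (sym length-encA)))

  nVars+2≤inputLength : n e + 2 ≤ length (encA e)
  nVars+2≤inputLength = ≤-trans (+-monoˡ-≤ 2 (m≤n+m (n e) (μs (initialBlocks e))))
    (≤-reflexive (trans (+-assoc (μs (initialBlocks e)) (n e) 2) (sym (trans length-encA (+-assoc (μs (initialBlocks e)) (n e) 2)))))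

  termCount≤inputLength : All (λ ts → length ts ≤ 0 + (length (encA e))) (termLists e)
  termCount≤inputLength = Data.List.Relation.Unary.All.map (λ le → ≤-trans le blkLen≤) (termCount≤digitBlocksLength (termLists e))
    where
    blkLen≤ : digitBlocksLength (termLists e) ≤ length (encA e)
    blkLen≤ = ≤-trans (m≤m+n (digitBlocksLength (termLists e)) (k e + n e + 2)) (≤-reflexive (trans (ar (digitBlocksLength (termLists e)) (k e) (n e))
                (trans (sym (len-inputTape e)) length-inputTape)))
      where
      ar : ∀ b k n → b + (k + n + 2) ≡ b + k + n + 2
      ar = solve-∀

  startup-run : Run (passBound (n e) (length (encA e))) Init (inputTape e) (Hd0 false) (roundTape (n e) (at 0 (n e)) (initialBlocks e)) 2
  startup-run = subst (λ z → Run B Init z (Hd0 false) (roundTape (n e) (at 0 (n e)) (initialBlocks e)) 2) (LP.++-identityʳ (inputTape e))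
    (rpass {ys = []} pass₀ size₀
      (subst (λ z → Run B S2 (CR ∷ X₀) (Hd0 false) z 1) X₀-round
        (rpass {xs = CR ∷ []} {ys = X₀} (Pass-one refl) size₁ rdone)))
    where
    B = passBound (n e) (length (encA e))
    Q = roundBound (n e) (length (encA e))
    X₀ = headerSyms (n e) (at 0 (n e)) ++ concatMap blockSyms (initialBlocks e)
    X₀-round : X₀ ++ CR ∷ [] ≡ roundTape (n e) (at 0 (n e)) (initialBlocks e)
    X₀-round = LP.++-assoc (headerSyms (n e) (at 0 (n e))) (concatMap blockSyms (initialBlocks e)) (CR ∷ [])
    round≤ : length (roundTape (n e) (at 0 (n e)) (initialBlocks e)) ≤ Q
    round≤ = len-roundTape (n e) (length (encA e)) (at 0 (n e)) (initialBlocks e) refl weight≤inputLength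
    twice≤B : ∀ x → x ≤ Q + Q → x ≤ B
    twice≤B x h = ≤-trans h (≤-trans (m≤m+n (Q + Q) (5 * Q)) (≤-reflexive (ar Q)))
      where
      ar : ∀ q → q + q + 5 * q ≡ 7 * q
      ar = solve-∀
    pass₀ : Pass Init (inputTape e) S2 (CR ∷ X₀)
    pass₀ = subst (λ z → Pass Init (inputTape e) S2 (CR ∷ headerSyms (n e) (at 0 (n e)) ++ concatMap blockSyms z))
      (sym (LP.map-∘ (termLists e))) (initial-pass (k e) (n e) (map flattenTerms (termLists e)))
    size₀ : length (inputTape e) + length {A = Γ} [] + length (CR ∷ X₀) ≤ B
    size₀ = twice≤B _ (+-mono-≤
      (≤-trans (≤-reflexive (trans (+-identityʳ _) length-inputTape))
               (≤-trans (m≤m*n′ (length (encA e)) (6 * length (encA e) + 12) (one≤C (length (encA e)))) (m≤n+m _ (n e + 3))))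
      (≤-trans (≤-reflexive (trans (+-comm 1 (length X₀)) (trans (sym (LP.length-++ X₀)) (cong length X₀-round)))) round≤))
    size₁ : length {A = Γ} (CR ∷ []) + length X₀ + length {A = Γ} (CR ∷ []) ≤ B
    size₁ = twice≤B _ (≤-trans (≤-reflexive (cong suc (trans (sym (LP.length-++ X₀)) (cong length X₀-round))))
      (+-mono-≤ (≤-trans (s≤s z≤n) (≤-trans (m≤n+m 3 (n e)) (m≤m+n (n e + 3) _))) round≤))

  encA-run : Σ ℕ λ P → (P ≤ length (encA e) * suc (n e) + 2) ×
             Run (passBound (n e) (length (encA e))) Init (map inputSym (encA e)) Halt (map inputSym (encB (reduce e))) (2 + P)
  encA-run with run-cycles (n e) (length (encA e)) (length (encA e)) 0 (at 0 (n e)) (termLists e) (inj₂ refl)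
                  (arity-termLists (V.toList (polys e))) termCount≤inputLength weight≤inputLength
  ... | P , P≤ , cycles =
    P , P≤ , subst₂ (λ u v → Run (passBound (n e) (length (encA e))) Init u Halt v (2 + P)) (sym (inputSym-encA e)) (sym (inputSym-encB e))
               (Run-++ startup-run cycles)

RunsTo-mono : ∀ {M w T T' v} → T ≤ T' → RunsTo M w T v → RunsTo M w T' v
RunsTo-mono T≤T' (t , t≤T , halted , output≡) = t , ≤-trans t≤T T≤T' , halted , output≡

initial-config : ∀ w → Σ Cell λ h → Σ (List Cell) λ r →
                 (initial machine w ≡ config (Read Init) [] h r) × Holds h r (map inputSym w)
initial-config [] = nothing , [] , refl , (nothing ∷ [] , refl ∷ [] , refl)
initial-config (s ∷ w) = embed s , map embed w , refl ,
  ([] , [] , cong (embed s ∷_) (trans (LP.map-∘ {g = just} {f = inputSym} w) (sym (LP.++-identityʳ (map just (map inputSym w))))))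

halted-RunsTo : ∀ {T w t l h r} v → t ≤ T → steps machine t (initial machine w) ≡ config (Read Halt) l h r →
                Holds h r (map inputSym v) → RunsTo machine w T v
halted-RunsTo {t = t} {l} {h} {r} v t≤T final≡ holds =
  t , t≤T , subst (Halted machine) (sym final≡) (halted l h r) ,
  trans (cong output final≡) (trans (output-rep l h r (map inputSym v) holds) (sym (LP.map-∘ {g = just} {f = inputSym} v)))

simulate-RunsTo : ∀ {B P} w v → Run B Init (map inputSym w) Halt (map inputSym v) P →
                  RunsTo machine w (P * (B * (2 * B + 3))) v
simulate-RunsTo w v run =
  let (h , r , initial≡ , holds) = initial-config w
      (t , t≤ , l' , h' , r' , steps≡ , _ , holds') = simulate-run run [] h r [] holds
  in halted-RunsTo v t≤ (trans (cong (steps machine t) initial≡) steps≡) holds'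

machine-runs : ∀ e → RunsTo machine (encA e) (timeExponent * suc (length (encA e)) ^ timeExponent) (encB (reduce e))
machine-runs e =
  let (P , P≤ , run) = encA-run e
  in RunsTo-mono (final-bound (length (encA e)) (n e) P (nVars+2≤inputLength e) P≤)
                 (simulate-RunsTo (encA e) (encB (reduce e)) run)

theorem6p6 : PolyTimeReducible encA encB ProbA ProbB
theorem6p6 = reduce , (machine , timeExponent , machine-runs) , reduction-correct
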